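{- Let $M$ be a simple matroid of rank $r$ with exactly $3r-3$ elements. Suppose that every line of $M$ has at most three elements, that all roots of the characteristic polynomial $\chi(M;\lambda)$ are real, and that $\chi(M;2)=0$. Then $M$ has at least $3r-5$ three-element circuits (equivalently, $3$-point lines). Moreover, $M$ has exactly $3r-5$ three-element circuits if and only if $\chi(M;\lambda)=(\lambda-1)(\lambda-2)(\lambda-3)^{r-2}$.
   Context: For a matroid $M$ with no rank-$0$ elements (loops), $\chi(M;\lambda)=\sum_{X\in L(M)}\mu(\emptyset,X)\lambda^{\mathrm{rank}(M)-\mathrm{rank}(X)}$, where $L(M)$ is the lattice of flats and $\mu$ its Möbius function; $\chi(M;\lambda)=0$ if $M$ has a loop. A line is a flat of rank $2$. A matroid is simple if it has no loops and no parallel elements. -}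

module Defs where

open import Level using (Level; 0ℓ) renaming (suc to lsuc; _⊔_ to _⊔ˡ_)
open import Data.Nat as ℕ using (ℕ; zero; suc; _<_; _≤_; _≟_)
import Data.Nat.Properties as ℕP
open import Data.Integer as ℤ using (ℤ; +_; -[1+_])
import Data.Integer.Properties as ℤP
open import Data.Fin using (Fin)
open import Data.Fin.Subset hiding (_∈_)
import Data.Fin.Subset as Sub
open import Data.Fin.Subset.Properties using (_∈?_; _⊂?_; nonempty?)
open import Data.Fin.Properties using (all?; any?)
open import Data.List as List using (List; []; _∷_; filter; length; map; foldr)
open import Data.List.Membership.Propositional using (_∈_)
open import Data.List.Membership.Propositional.Properties using (∈-map⁺; ∈-++⁺ˡ; ∈-++⁺ʳ)
open import Data.List.Relation.Unary.All as All using (All)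
import Data.List.Relation.Unary.Any as Any
open import Data.Vec as Vec using (Vec)
open import Data.Product using (Σ; ∃; _×_; _,_)
open import Data.Bool using (true; false)
open import Relation.Nullary using (¬_; Dec; yes; no)
open import Relation.Nullary.Decidable using (¬?; _×-dec_; _→-dec_)
open import Relation.Binary using (Rel; IsTotalOrder)
open import Relation.Binary.PropositionalEquality using (_≡_; refl)
open import Algebra.Bundles using (CommutativeRing)

record Matroid (n : ℕ) : Set where
  field
    rk   : Subset n → ℕ
    rk-card  : ∀ X → rk X ≤ ∣ X ∣
    rk-mono  : ∀ X Y → X ⊆ Y → rk X ≤ rk Y
    rk-submod : ∀ X Y → rk (X ∪ Y) ℕ.+ rk (X ∩ Y) ≤ rk X ℕ.+ rk Y

module _ {n : ℕ} (M : Matroid n) where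
  open Matroid M

  rank : ℕ
  rank = rk ⊤

  IsLoop : Fin n → Set
  IsLoop e = rk ⁅ e ⁆ ≡ 0

  IsSimple : Set
  IsSimple = (∀ e → ¬ IsLoop e)
           × (∀ e f → ¬ (e ≡ f) → ¬ (rk (⁅ e ⁆ ∪ ⁅ f ⁆) < 2))

  IsFlat : Subset n → Set
  IsFlat X = ∀ e → ¬ (e Sub.∈ X) → rk X < rk (X ∪ ⁅ e ⁆)

  isFlat? : ∀ X → Dec (IsFlat X)
  isFlat? X = all? (λ e → ¬? (e ∈? X) →-dec (rk X ℕ.<? rk (X ∪ ⁅ e ⁆)))

  IsLine : Subset n → Set
  IsLine X = IsFlat X × rk X ≡ 2

  IsIndependent : Subset n → Set
  IsIndependent X = rk X ≡ ∣ X ∣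

  IsCircuit : Subset n → Set
  IsCircuit C = ¬ IsIndependent C × (∀ D → D ⊂ C → IsIndependent D)

subsets : ∀ n → List (Subset n)
subsets zero    = Vec.[] ∷ []
subsets (suc n) = map (true Vec.∷_) (subsets n) List.++ map (false Vec.∷_) (subsets n)

subsets-complete : ∀ {n} (X : Subset n) → X ∈ subsets n
subsets-complete Vec.[] = Any.here refl
subsets-complete {suc n} (true Vec.∷ X) = ∈-++⁺ˡ (∈-map⁺ (true Vec.∷_) (subsets-complete X))
subsets-complete {suc n} (false Vec.∷ X) =
  ∈-++⁺ʳ (map (true Vec.∷_) (subsets n)) (∈-map⁺ (false Vec.∷_) (subsets-complete X))

allSubsets? : ∀ {n} {P : Subset n → Set} → (∀ X → Dec (P X)) → Dec (∀ X → P X)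
allSubsets? {n} P? with All.all? P? (subsets n)
... | yes a = yes (λ X → All.lookup a (subsets-complete X))
... | no ¬a = no (λ h → ¬a (All.tabulate (λ {X} _ → h X)))

sumℤ : List ℤ → ℤ
sumℤ = foldr ℤ._+_ (+ 0)

module _ {n : ℕ} (M : Matroid n) where
  open Matroid M

  isIndependent? : ∀ X → Dec (IsIndependent M X)
  isIndependent? X = rk X ≟ ∣ X ∣

  isCircuit? : ∀ C → Dec (IsCircuit M C)
  isCircuit? C = ¬? (isIndependent? C)
           ×-dec allSubsets? (λ D → (D ⊂? C) →-dec isIndependent? D)

  numTriangles : ℕ
  numTriangles = length (filter (λ C → (∣ C ∣ ≟ 3) ×-dec isCircuit? C) (subsets n))

  flats : List (Subset n)
  flats = filter (isFlat? M) (subsets n)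

  -- Moebius function mu(emptyset, X) of the lattice of flats, for X a flat
  -- (for loopless M the bottom flat is the empty set).  Defined by the
  -- recursion mu(0,0) = 1, mu(0,X) = - sum_{Y flat, Y proper subset of X} mu(0,Y),
  -- using fuel (any fuel >= |X| gives the correct value).
  muF : ℕ → Subset n → ℤ
  muF zero    X = + 1
  muF (suc k) X with nonempty? X
  ... | no  _ = + 1
  ... | yes _ = ℤ.- sumℤ (map (muF k) (filter (_⊂? X) flats))

  mu : Subset n → ℤ
  mu X = muF n X

  -- coefficient of lambda^k in chi(M; lambda); zero if M has a loop
  chiCoeff : ℕ → ℤ
  chiCoeff k with any? (λ e → rk ⁅ e ⁆ ≟ 0)
  ... | yes _ = + 0
  ... | no  _ = sumℤ (map mu (filter (λ X → rk X ℕ.+ k ≟ rank M) flats))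

  chiPoly : List ℤ
  chiPoly = map chiCoeff (List.upTo (suc (rank M)))

-- Univariate polynomials over a commutative ring, as coefficient lists
-- (index = degree).

module Poly {c ℓ} (R : CommutativeRing c ℓ) where
  open CommutativeRing R

  _+ₚ_ : List Carrier → List Carrier → List Carrier
  [] +ₚ q = q
  (a ∷ p) +ₚ [] = a ∷ p
  (a ∷ p) +ₚ (b ∷ q) = (a + b) ∷ (p +ₚ q)

  _*ₚ_ : List Carrier → List Carrier → List Carrier
  [] *ₚ q = []
  (a ∷ p) *ₚ q = map (a *_) q +ₚ (0# ∷ (p *ₚ q))

  _^ₚ_ : List Carrier → ℕ → List Carrier
  p ^ₚ zero = 1# ∷ []
  p ^ₚ suc k = p *ₚ (p ^ₚ k)

  coeff : List Carrier → ℕ → Carrier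
  coeff [] k = 0#
  coeff (a ∷ p) zero = a
  coeff (a ∷ p) (suc k) = coeff p k

  eval : List Carrier → Carrier → Carrier
  eval [] x = 0#
  eval (a ∷ p) x = a + x * eval p x

  X-_ : Carrier → List Carrier
  X- a = (- a) ∷ 1# ∷ []

  linProd : List Carrier → List Carrier
  linProd = foldr (λ a p → (X- a) *ₚ p) (1# ∷ [])

  fromℕ : ℕ → Carrier
  fromℕ zero = 0#
  fromℕ (suc k) = 1# + fromℕ k

  fromℤ : ℤ → Carrier
  fromℤ (+ k) = fromℕ k
  fromℤ -[1+ k ] = - fromℕ (suc k)

  _≈ₚ_ : List Carrier → List Carrier → Set ℓ
  p ≈ₚ q = ∀ k → coeff p k ≈ coeff q k

record OrderedField (c ℓ₁ ℓ₂ : Level) : Set (lsuc (c ⊔ˡ ℓ₁ ⊔ˡ ℓ₂)) where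
  field
    commutativeRing : CommutativeRing c ℓ₁
  open CommutativeRing commutativeRing public
  field
    _≤ₒ_         : Rel Carrier ℓ₂
    isTotalOrder : IsTotalOrder _≈_ _≤ₒ_
    0≉1          : ¬ (0# ≈ 1#)
    inverse      : ∀ x → ¬ (x ≈ 0#) → ∃ λ y → x * y ≈ 1#
    +-mono-≤ₒ    : ∀ x y z → x ≤ₒ y → (x + z) ≤ₒ (y + z)
    *-nonneg     : ∀ x y → 0# ≤ₒ x → 0# ≤ₒ y → 0# ≤ₒ (x * y)

-- Real-rootedness of an integer polynomial p of degree d, relative to an
-- ordered field K: p = prod_{i=1}^d (x - a_i) with all a_i in K.
AllRootsIn : ∀ {c ℓ₁ ℓ₂} (K : OrderedField c ℓ₁ ℓ₂) → ℕ → List ℤ → Set (c ⊔ˡ ℓ₁)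
AllRootsIn K d p = ∃ λ (as : Vec Carrier d) → map fromℤ p ≈ₚ linProd (Vec.toList as)
  where open OrderedField K
        open Poly commutativeRing

open Poly ℤP.+-*-commutativeRing public
  using () renaming (_*ₚ_ to _*ℤ_; _^ₚ_ to _^ℤ_; coeff to coeffℤ; eval to evalℤ; X-_ to linℤ)

chi : ∀ {n} → Matroid n → ℤ → ℤ
chi M x = evalℤ (chiPoly M) x

module Submission where

-- Write χ = ∏ (λ - bᵢ).  By Whitney's formula the coefficient of
-- λ^(r-1) is -n (the rank-1 flats are the n points, μ = -1) and that of
-- λ^(r-2) is Σ_L μ(L) = Σ_L (|L| - 1) over the lines L.  Every ordered pair
-- of distinct points lies on exactly one line and lines have 2 or 3 points,
-- so 2[λ^(r-2)] + 2t + n = n².  By Vieta, Σ bᵢ = n and Σ bᵢ² = 2t + n, hence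
-- Σ (bᵢ - 3)² = 2t - 6r + 15.  Since χ(1) = Σ_X μ(X) = 0 and χ(2) = 0, the
-- roots 1 and 2 contribute (1-3)² + (2-3)² = 5 to this sum of squares, so
-- 3r ≤ t + 5, with equality iff all other roots equal 3.

module IntegerImage where

  open import Defs using (module Poly)
  open import Data.Nat as ℕ using (zero; suc)
  import Data.Nat.Properties as ℕP
  open import Data.Integer as ℤ using (ℤ; +_; -[1+_]; _⊖_)
  import Data.Integer.Properties as ℤP
  open import Relation.Binary.PropositionalEquality as ≡ using (_≡_)
  open import Relation.Nullary using (yes; no)
  open import Algebra.Bundles using (CommutativeRing)
  open import Data.Maybe using (Maybe; nothing; just)
  import Algebra.Solver.Ring
  import Algebra.Solver.Ring.AlmostCommutativeRing as ACR

  -- In every commutative ring R the canonical map ℤ → R (Poly.fromℤ) is a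
  -- ring homomorphism.  This yields a ring solver for R whose constants are
  -- integers, which is what makes numerical identities in an arbitrary
  -- ordered field provable by normalisation.
  module Canonical {c ℓ} (R : CommutativeRing c ℓ) where
    open CommutativeRing R hiding (zero)
    open Poly R using (fromℕ; fromℤ)
    open import Algebra.Properties.Ring ring using (-‿distribˡ-*; -‿distribʳ-*)
    open import Algebra.Properties.AbelianGroup +-abelianGroup using (⁻¹-∙-comm; xyx⁻¹≈y)
    open import Algebra.Properties.Group +-group using (⁻¹-involutive; ε⁻¹≈ε)
    open import Relation.Binary.Reasoning.Setoid setoid

    neg-+ : ∀ x y → - (x + y) ≈ - x + - y
    neg-+ x y = sym (⁻¹-∙-comm x y)

    neg-neg : ∀ x → - - x ≈ x
    neg-neg = ⁻¹-involutive

    fromℕ-cong : ∀ {a b} → a ≡ b → fromℕ a ≈ fromℕ b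
    fromℕ-cong ≡.refl = refl

    fromℤ-cong : ∀ {i j} → i ≡ j → fromℤ i ≈ fromℤ j
    fromℤ-cong ≡.refl = refl

    fromℕ-+ : ∀ a b → fromℕ (a ℕ.+ b) ≈ fromℕ a + fromℕ b
    fromℕ-+ zero    b = sym (+-identityˡ _)
    fromℕ-+ (suc a) b = trans (+-congˡ (fromℕ-+ a b)) (sym (+-assoc _ _ _))

    fromℕ-* : ∀ a b → fromℕ (a ℕ.* b) ≈ fromℕ a * fromℕ b
    fromℕ-* zero    b = sym (zeroˡ _)
    fromℕ-* (suc a) b = begin
      fromℕ (b ℕ.+ a ℕ.* b)       ≈⟨ fromℕ-+ b (a ℕ.* b) ⟩
      fromℕ b + fromℕ (a ℕ.* b)   ≈⟨ +-congˡ (fromℕ-* a b) ⟩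
      fromℕ b + fromℕ a * fromℕ b ≈⟨ +-congʳ (sym (*-identityˡ _)) ⟩
      1# * fromℕ b + fromℕ a * fromℕ b ≈⟨ sym (distribʳ _ _ _) ⟩
      (1# + fromℕ a) * fromℕ b    ∎

    fromℤ-neg : ∀ i → fromℤ (ℤ.- i) ≈ - fromℤ i
    fromℤ-neg (+ zero)  = sym ε⁻¹≈ε
    fromℤ-neg (+ suc p) = refl
    fromℤ-neg -[1+ p ]  = sym (neg-neg _)

    fromℤ-⊖ : ∀ m n → fromℤ (m ⊖ n) ≈ fromℕ m + - fromℕ n
    fromℤ-⊖ zero    zero    = sym (trans (+-congˡ ε⁻¹≈ε) (+-identityʳ _))
    fromℤ-⊖ zero    (suc n) = sym (+-identityˡ _)
    fromℤ-⊖ (suc m) zero    = sym (trans (+-congˡ ε⁻¹≈ε) (+-identityʳ _))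
    fromℤ-⊖ (suc m) (suc n) = begin
      fromℤ (suc m ⊖ suc n)               ≡⟨ ≡.cong fromℤ (ℤP.[1+m]⊖[1+n]≡m⊖n m n) ⟩
      fromℤ (m ⊖ n)                       ≈⟨ fromℤ-⊖ m n ⟩
      fromℕ m + - fromℕ n                 ≈⟨ +-congʳ (xyx⁻¹≈y 1# (fromℕ m)) ⟨
      ((1# + fromℕ m) + - 1#) + - fromℕ n ≈⟨ +-assoc _ _ _ ⟩
      (1# + fromℕ m) + (- 1# + - fromℕ n) ≈⟨ +-congˡ (neg-+ 1# (fromℕ n)) ⟨
      (1# + fromℕ m) + - (1# + fromℕ n)   ∎

    fromℤ-+ : ∀ i j → fromℤ (i ℤ.+ j) ≈ fromℤ i + fromℤ j
    fromℤ-+ (+ m)    (+ n)    = fromℕ-+ m n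
    fromℤ-+ (+ m)    -[1+ n ] = fromℤ-⊖ m (suc n)
    fromℤ-+ -[1+ m ] (+ n)    = trans (fromℤ-⊖ n (suc m)) (+-comm _ _)
    fromℤ-+ -[1+ m ] -[1+ n ] = begin
      - fromℕ (suc (suc (m ℕ.+ n)))       ≡⟨ ≡.cong (λ k → - fromℕ k) (ℕP.+-suc (suc m) n) ⟨
      - fromℕ (suc m ℕ.+ suc n)           ≈⟨ -‿cong (fromℕ-+ (suc m) (suc n)) ⟩
      - (fromℕ (suc m) + fromℕ (suc n))   ≈⟨ neg-+ _ _ ⟩
      - fromℕ (suc m) + - fromℕ (suc n)   ∎

    fromℤ-*-negʳ : ∀ i m → fromℤ (i ℤ.* + suc m) ≈ fromℤ i * fromℕ (suc m) →
                   fromℤ (i ℤ.* -[1+ m ]) ≈ fromℤ i * fromℤ -[1+ m ]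
    fromℤ-*-negʳ i m h = begin
      fromℤ (i ℤ.* ℤ.- + suc m)   ≡⟨ ≡.cong fromℤ (ℤP.neg-distribʳ-* i (+ suc m)) ⟨
      fromℤ (ℤ.- (i ℤ.* + suc m)) ≈⟨ fromℤ-neg (i ℤ.* + suc m) ⟩
      - fromℤ (i ℤ.* + suc m)     ≈⟨ -‿cong h ⟩
      - (fromℤ i * fromℕ (suc m)) ≈⟨ -‿distribʳ-* _ _ ⟩
      fromℤ i * - fromℕ (suc m)   ∎

    fromℤ-*-pos : ∀ m j → fromℤ (+ m ℤ.* j) ≈ fromℕ m * fromℤ j
    fromℤ-*-pos m (+ n)    = trans (fromℤ-cong (≡.sym (ℤP.pos-* m n))) (fromℕ-* m n)
    fromℤ-*-pos m -[1+ n ] = fromℤ-*-negʳ (+ m) n (fromℤ-*-pos m (+ suc n))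

    fromℤ-* : ∀ i j → fromℤ (i ℤ.* j) ≈ fromℤ i * fromℤ j
    fromℤ-* (+ m)    j = fromℤ-*-pos m j
    fromℤ-* -[1+ m ] j = begin
      fromℤ (ℤ.- + suc m ℤ.* j)   ≡⟨ ≡.cong fromℤ (ℤP.neg-distribˡ-* (+ suc m) j) ⟨
      fromℤ (ℤ.- (+ suc m ℤ.* j)) ≈⟨ fromℤ-neg (+ suc m ℤ.* j) ⟩
      - fromℤ (+ suc m ℤ.* j)     ≈⟨ -‿cong (fromℤ-*-pos (suc m) j) ⟩
      - (fromℕ (suc m) * fromℤ j) ≈⟨ -‿distribˡ-* _ _ ⟩
      - fromℕ (suc m) * fromℤ j   ∎

    -- The solver.  The constant 1 is interpreted as 1# itself (not 1# + 0#)
    -- so that the homomorphism sends 1 to 1# definitionally.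
    constant : ℤ → Carrier
    constant (+ 1) = 1#
    constant i     = fromℤ i

    constant≈fromℤ : ∀ i → constant i ≈ fromℤ i
    constant≈fromℤ (+ zero)          = refl
    constant≈fromℤ (+ suc zero)      = sym (+-identityʳ 1#)
    constant≈fromℤ (+ suc (suc p))   = refl
    constant≈fromℤ -[1+ p ]          = refl

    private
      almostRing : ACR.AlmostCommutativeRing c ℓ
      almostRing = ACR.fromCommutativeRing R

      constantHom : CommutativeRing.rawRing ℤP.+-*-commutativeRing ACR.-Raw-AlmostCommutative⟶ almostRing
      constantHom = record
        { ⟦_⟧    = constant
        ; +-homo = λ i j → lift₂ {i} {j} {i ℤ.+ j} _+_ +-cong (fromℤ-+ i j)
        ; *-homo = λ i j → lift₂ {i} {j} {i ℤ.* j} _*_ *-cong (fromℤ-* i j)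
        ; -‿homo = λ i → trans (constant≈fromℤ (ℤ.- i)) (trans (fromℤ-neg i) (sym (-‿cong (constant≈fromℤ i))))
        ; 0-homo = refl
        ; 1-homo = refl }
        where
        lift₂ : ∀ {i j k} (_∙_ : Carrier → Carrier → Carrier) →
                (∀ {a a' b b'} → a ≈ a' → b ≈ b' → (a ∙ b) ≈ (a' ∙ b')) →
                fromℤ k ≈ (fromℤ i ∙ fromℤ j) → constant k ≈ (constant i ∙ constant j)
        lift₂ {i} {j} {k} _∙_ ∙-cong e =
          trans (constant≈fromℤ k) (trans e (sym (∙-cong (constant≈fromℤ i) (constant≈fromℤ j))))

      -- equality of integer constants (the solver only needs a sound test)
      constantsEqual? : ∀ i j → Maybe (constant i ≈ constant j)
      constantsEqual? i j with i ℤ.≟ j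
      ... | yes ≡.refl = just refl
      ... | no _       = nothing

    open Algebra.Solver.Ring _ almostRing constantHom constantsEqual? public
      using (_:=_; _:+_; _:*_; :-_; con)
      renaming (solve to zsolve)

module Polynomials where

  open import Defs using (module Poly)
  open import Data.Nat as ℕ using (ℕ; zero; suc; s≤s)
  import Data.Nat.Properties as ℕP
  open import Data.Integer using (+_)
  open import Data.List using (List; []; _∷_; map; length)
  open import Data.List.Relation.Unary.Any using (Any; here; there)
  open import Data.List.Relation.Binary.Pointwise using (Pointwise; []; _∷_)
  open import Relation.Binary.PropositionalEquality as ≡ using (_≡_)
  open import Algebra.Bundles using (CommutativeRing)
  import Level
  open IntegerImage

  module Over {c ℓ} (R : CommutativeRing c ℓ) where
    open CommutativeRing R hiding (zero)
    open Poly R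
    open Canonical R
    open import Relation.Binary.Reasoning.Setoid setoid

    sumOf : (Carrier → Carrier) → List Carrier → Carrier
    sumOf g []       = 0#
    sumOf g (a ∷ as) = g a + sumOf g as

    coeff-+ₚ : ∀ p q k → coeff (p +ₚ q) k ≈ coeff p k + coeff q k
    coeff-+ₚ []      q       k       = sym (+-identityˡ _)
    coeff-+ₚ (a ∷ p) []      k       = sym (+-identityʳ _)
    coeff-+ₚ (a ∷ p) (b ∷ q) zero    = refl
    coeff-+ₚ (a ∷ p) (b ∷ q) (suc k) = coeff-+ₚ p q k

    coeff-scale : ∀ a q k → coeff (map (a *_) q) k ≈ a * coeff q k
    coeff-scale a []      k       = sym (zeroʳ a)
    coeff-scale a (b ∷ q) zero    = refl
    coeff-scale a (b ∷ q) (suc k) = coeff-scale a q k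

    coeffShift : List Carrier → ℕ → Carrier
    coeffShift q zero    = 0#
    coeffShift q (suc k) = coeff q k

    coeff-linear : ∀ c₀ c₁ q k → coeff ((c₀ ∷ c₁ ∷ []) *ₚ q) k ≈ c₀ * coeff q k + c₁ * coeffShift q k
    coeff-linear c₀ c₁ q zero = begin
      coeff (map (c₀ *_) q +ₚ (0# ∷ ((c₁ ∷ []) *ₚ q))) zero ≈⟨ coeff-+ₚ (map (c₀ *_) q) _ zero ⟩
      coeff (map (c₀ *_) q) zero + 0# ≈⟨ +-cong (coeff-scale c₀ q zero) (sym (zeroʳ c₁)) ⟩
      c₀ * coeff q zero + c₁ * 0#     ∎
    coeff-linear c₀ c₁ q (suc k) = begin
      coeff (map (c₀ *_) q +ₚ (0# ∷ (map (c₁ *_) q +ₚ (0# ∷ [])))) (suc k)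
        ≈⟨ coeff-+ₚ (map (c₀ *_) q) _ (suc k) ⟩
      coeff (map (c₀ *_) q) (suc k) + coeff (map (c₁ *_) q +ₚ (0# ∷ [])) k
        ≈⟨ +-cong (coeff-scale c₀ q (suc k)) (coeff-+ₚ (map (c₁ *_) q) _ k) ⟩
      c₀ * coeff q (suc k) + (coeff (map (c₁ *_) q) k + coeff (0# ∷ []) k)
        ≈⟨ +-congˡ (trans (+-cong (coeff-scale c₁ q k) (coeff-zero k)) (+-identityʳ _)) ⟩
      c₀ * coeff q (suc k) + c₁ * coeff q k ∎
      where
      coeff-zero : ∀ k → coeff (0# ∷ []) k ≈ 0#
      coeff-zero zero    = refl
      coeff-zero (suc k) = refl

    linear-cong : ∀ {c₀ c₁ d₀ d₁} q q' → c₀ ≈ d₀ → c₁ ≈ d₁ → q ≈ₚ q' →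
                  ((c₀ ∷ c₁ ∷ []) *ₚ q) ≈ₚ ((d₀ ∷ d₁ ∷ []) *ₚ q')
    linear-cong {c₀} {c₁} {d₀} {d₁} q q' e₀ e₁ e k = begin
      coeff ((c₀ ∷ c₁ ∷ []) *ₚ q) k       ≈⟨ coeff-linear c₀ c₁ q k ⟩
      c₀ * coeff q k + c₁ * coeffShift q k ≈⟨ +-cong (*-cong e₀ (e k)) (*-cong e₁ (shift-cong k)) ⟩
      d₀ * coeff q' k + d₁ * coeffShift q' k ≈⟨ coeff-linear d₀ d₁ q' k ⟨
      coeff ((d₀ ∷ d₁ ∷ []) *ₚ q') k       ∎
      where
      shift-cong : ∀ k → coeffShift q k ≈ coeffShift q' k
      shift-cong zero    = refl
      shift-cong (suc k) = e k

    X-cong : ∀ {a b} q q' → a ≈ b → q ≈ₚ q' → ((X- a) *ₚ q) ≈ₚ ((X- b) *ₚ q')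
    X-cong q q' e f = linear-cong q q' (-‿cong e) refl f

    coeff-X-zero : ∀ a q → coeff ((X- a) *ₚ q) zero ≈ - a * coeff q zero
    coeff-X-zero a q = trans (coeff-linear (- a) 1# q zero) (trans (+-congˡ (zeroʳ 1#)) (+-identityʳ _))

    coeff-X-suc : ∀ a q k → coeff ((X- a) *ₚ q) (suc k) ≈ - a * coeff q (suc k) + coeff q k
    coeff-X-suc a q k = trans (coeff-linear (- a) 1# q (suc k)) (+-congˡ (*-identityˡ _))

    X-comm : ∀ a b q → ((X- a) *ₚ ((X- b) *ₚ q)) ≈ₚ ((X- b) *ₚ ((X- a) *ₚ q))
    X-comm a b q zero = begin
      coeff ((X- a) *ₚ ((X- b) *ₚ q)) zero ≈⟨ coeff-X-zero a ((X- b) *ₚ q) ⟩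
      - a * coeff ((X- b) *ₚ q) zero       ≈⟨ *-congˡ (coeff-X-zero b q) ⟩
      - a * (- b * coeff q zero)           ≈⟨ zsolve 3 (λ a b x → (:- a :* (:- b :* x)) := (:- b :* (:- a :* x))) refl a b (coeff q zero) ⟩
      - b * (- a * coeff q zero)           ≈⟨ *-congˡ (coeff-X-zero a q) ⟨
      - b * coeff ((X- a) *ₚ q) zero       ≈⟨ coeff-X-zero b ((X- a) *ₚ q) ⟨
      coeff ((X- b) *ₚ ((X- a) *ₚ q)) zero ∎
    X-comm a b q (suc k) = begin
      coeff ((X- a) *ₚ ((X- b) *ₚ q)) (suc k)
        ≈⟨ coeff-X-suc a ((X- b) *ₚ q) k ⟩
      - a * coeff ((X- b) *ₚ q) (suc k) + coeff ((X- b) *ₚ q) k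
        ≈⟨ +-cong (*-congˡ (coeff-X-suc b q k)) (coeff-linear (- b) 1# q k) ⟩
      - a * (- b * coeff q (suc k) + coeff q k) + (- b * coeff q k + 1# * coeffShift q k)
        ≈⟨ zsolve 5 (λ a b x y z → (:- a :* (:- b :* x :+ y) :+ (:- b :* y :+ con (+ 1) :* z))
                                  := (:- b :* (:- a :* x :+ y) :+ (:- a :* y :+ con (+ 1) :* z)))
                    refl a b (coeff q (suc k)) (coeff q k) (coeffShift q k) ⟩
      - b * (- a * coeff q (suc k) + coeff q k) + (- a * coeff q k + 1# * coeffShift q k)
        ≈⟨ +-cong (*-congˡ (coeff-X-suc a q k)) (coeff-linear (- a) 1# q k) ⟨
      - b * coeff ((X- a) *ₚ q) (suc k) + coeff ((X- a) *ₚ q) k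
        ≈⟨ coeff-X-suc b ((X- a) *ₚ q) k ⟨
      coeff ((X- b) *ₚ ((X- a) *ₚ q)) (suc k) ∎

    e₂ : List Carrier → Carrier
    e₂ []       = 0#
    e₂ (a ∷ as) = a * sumOf (λ b → b) as + e₂ as

    coeff-linProd-above : ∀ as k → length as ℕ.< k → coeff (linProd as) k ≈ 0#
    coeff-linProd-above []       (suc k) _         = refl
    coeff-linProd-above (a ∷ as) (suc k) (s≤s lt) = begin
      coeff ((X- a) *ₚ linProd as) (suc k)               ≈⟨ coeff-X-suc a (linProd as) k ⟩
      - a * coeff (linProd as) (suc k) + coeff (linProd as) k
        ≈⟨ +-cong (*-congˡ (coeff-linProd-above as (suc k) (ℕP.m≤n⇒m≤1+n lt))) (coeff-linProd-above as k lt) ⟩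
      - a * 0# + 0#                                      ≈⟨ zsolve 1 (λ a → (:- a :* con (+ 0) :+ con (+ 0)) := con (+ 0)) refl a ⟩
      0#                                                 ∎

    coeff-linProd-lead : ∀ as → coeff (linProd as) (length as) ≈ 1#
    coeff-linProd-lead []       = refl
    coeff-linProd-lead (a ∷ as) = begin
      coeff ((X- a) *ₚ linProd as) (suc (length as))        ≈⟨ coeff-X-suc a (linProd as) (length as) ⟩
      - a * coeff (linProd as) (suc (length as)) + coeff (linProd as) (length as)
        ≈⟨ +-cong (*-congˡ (coeff-linProd-above as _ ℕP.≤-refl)) (coeff-linProd-lead as) ⟩
      - a * 0# + 1#                                         ≈⟨ zsolve 1 (λ a → (:- a :* con (+ 0) :+ con (+ 1)) := con (+ 1)) refl a ⟩
      1#                                                    ∎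

    coeff-linProd-e₁ : ∀ as k → length as ≡ suc k → coeff (linProd as) k ≈ - sumOf (λ b → b) as
    coeff-linProd-e₁ (a ∷ []) zero _ = begin
      coeff ((X- a) *ₚ linProd []) zero ≈⟨ coeff-X-zero a (linProd []) ⟩
      - a * 1#                          ≈⟨ zsolve 1 (λ a → (:- a :* con (+ 1)) := (:- (a :+ con (+ 0)))) refl a ⟩
      - (a + 0#)                        ∎
    coeff-linProd-e₁ (a ∷ as) (suc k) len = begin
      coeff ((X- a) *ₚ linProd as) (suc k)                   ≈⟨ coeff-X-suc a (linProd as) k ⟩
      - a * coeff (linProd as) (suc k) + coeff (linProd as) k
        ≈⟨ +-cong (*-congˡ lead) (coeff-linProd-e₁ as k len') ⟩
      - a * 1# + - sumOf (λ b → b) as                        ≈⟨ zsolve 2 (λ a s → (:- a :* con (+ 1) :+ :- s) := (:- (a :+ s))) refl a _ ⟩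
      - (a + sumOf (λ b → b) as)                             ∎
      where
      len' = ℕP.suc-injective len
      lead : coeff (linProd as) (suc k) ≈ 1#
      lead = ≡.subst (λ m → coeff (linProd as) m ≈ 1#) len' (coeff-linProd-lead as)

    coeff-linProd-e₂ : ∀ as k → length as ≡ suc (suc k) → coeff (linProd as) k ≈ e₂ as
    coeff-linProd-e₂ (a ∷ b ∷ []) zero _ = begin
      coeff ((X- a) *ₚ linProd (b ∷ [])) zero ≈⟨ coeff-X-zero a (linProd (b ∷ [])) ⟩
      - a * coeff (linProd (b ∷ [])) zero     ≈⟨ *-congˡ (coeff-linProd-e₁ (b ∷ []) zero ≡.refl) ⟩
      - a * - (b + 0#)                        ≈⟨ zsolve 2 (λ a b → (:- a :* :- (b :+ con (+ 0))) := (a :* (b :+ con (+ 0)) :+ (b :* con (+ 0) :+ con (+ 0)))) refl a b ⟩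
      e₂ (a ∷ b ∷ [])                         ∎
    coeff-linProd-e₂ (a ∷ as) (suc k) len = begin
      coeff ((X- a) *ₚ linProd as) (suc k)                   ≈⟨ coeff-X-suc a (linProd as) k ⟩
      - a * coeff (linProd as) (suc k) + coeff (linProd as) k
        ≈⟨ +-cong (*-congˡ (coeff-linProd-e₁ as (suc k) len')) (coeff-linProd-e₂ as k len') ⟩
      - a * - sumOf (λ b → b) as + e₂ as                    ≈⟨ zsolve 3 (λ a s t → (:- a :* :- s :+ t) := (a :* s :+ t)) refl a _ _ ⟩
      e₂ (a ∷ as)                                            ∎
      where len' = ℕP.suc-injective len

    newton₂ : ∀ as → e₂ as + e₂ as ≈ sumOf (λ b → b) as * sumOf (λ b → b) as + - sumOf (λ b → b * b) as
    newton₂ []       = zsolve 0 ((con (+ 0) :+ con (+ 0)) := (con (+ 0) :* con (+ 0) :+ :- con (+ 0))) refl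
    newton₂ (a ∷ as) = begin
      (a * s + e₂ as) + (a * s + e₂ as)       ≈⟨ zsolve 3 (λ a s t → ((a :* s :+ t) :+ (a :* s :+ t)) := ((a :* s :+ a :* s) :+ (t :+ t))) refl a s (e₂ as) ⟩
      (a * s + a * s) + (e₂ as + e₂ as)       ≈⟨ +-congˡ (newton₂ as) ⟩
      (a * s + a * s) + (s * s + - q)         ≈⟨ zsolve 3 (λ a s q → ((a :* s :+ a :* s) :+ (s :* s :+ :- q)) := ((a :+ s) :* (a :+ s) :+ :- (a :* a :+ q))) refl a s q ⟩
      (a + s) * (a + s) + - (a * a + q)       ∎
      where
      s = sumOf (λ b → b) as
      q = sumOf (λ b → b * b) as

    sqDev : Carrier → Carrier → Carrier
    sqDev c b = (b + - c) * (b + - c)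

    sumSqDev-expand : ∀ c as → sumOf (sqDev c) as + (c + c) * sumOf (λ b → b) as
                               ≈ sumOf (λ b → b * b) as + fromℕ (length as) * (c * c)
    sumSqDev-expand c [] = zsolve 1 (λ c → (con (+ 0) :+ (c :+ c) :* con (+ 0)) := (con (+ 0) :+ con (+ 0) :* (c :* c))) refl c
    sumSqDev-expand c (b ∷ bs) = begin
      ((b + - c) * (b + - c) + d) + (c + c) * (b + s)
        ≈⟨ zsolve 4 (λ b c d s → (((b :+ :- c) :* (b :+ :- c) :+ d) :+ (c :+ c) :* (b :+ s))
                                := (((b :+ :- c) :* (b :+ :- c) :+ (c :+ c) :* b) :+ (d :+ (c :+ c) :* s))) refl b c d s ⟩
      ((b + - c) * (b + - c) + (c + c) * b) + (d + (c + c) * s)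
        ≈⟨ +-congˡ (sumSqDev-expand c bs) ⟩
      ((b + - c) * (b + - c) + (c + c) * b) + (q + fromℕ (length bs) * (c * c))
        ≈⟨ zsolve 4 (λ b c q l → (((b :+ :- c) :* (b :+ :- c) :+ (c :+ c) :* b) :+ (q :+ l :* (c :* c)))
                                := ((b :* b :+ q) :+ (con (+ 1) :+ l) :* (c :* c))) refl b c q (fromℕ (length bs)) ⟩
      (b * b + q) + (1# + fromℕ (length bs)) * (c * c) ∎
      where
      d = sumOf (λ b → (b + - c) * (b + - c)) bs
      s = sumOf (λ b → b) bs
      q = sumOf (λ b → b * b) bs

    eval-+ₚ : ∀ p q x → eval (p +ₚ q) x ≈ eval p x + eval q x
    eval-+ₚ []      q       x = sym (+-identityˡ _)
    eval-+ₚ (a ∷ p) []      x = sym (+-identityʳ _)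
    eval-+ₚ (a ∷ p) (b ∷ q) x = begin
      (a + b) + x * eval (p +ₚ q) x           ≈⟨ +-congˡ (*-congˡ (eval-+ₚ p q x)) ⟩
      (a + b) + x * (eval p x + eval q x)
        ≈⟨ zsolve 5 (λ a b x u v → ((a :+ b) :+ x :* (u :+ v)) := ((a :+ x :* u) :+ (b :+ x :* v))) refl a b x _ _ ⟩
      (a + x * eval p x) + (b + x * eval q x) ∎

    eval-scale : ∀ c q x → eval (map (c *_) q) x ≈ c * eval q x
    eval-scale c []      x = sym (zeroʳ c)
    eval-scale c (a ∷ q) x = begin
      c * a + x * eval (map (c *_) q) x ≈⟨ +-congˡ (*-congˡ (eval-scale c q x)) ⟩
      c * a + x * (c * eval q x)        ≈⟨ zsolve 4 (λ c a x u → (c :* a :+ x :* (c :* u)) := (c :* (a :+ x :* u))) refl c a x _ ⟩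
      c * (a + x * eval q x)            ∎

    eval-linear : ∀ c₀ c₁ q x → eval ((c₀ ∷ c₁ ∷ []) *ₚ q) x ≈ (c₀ + c₁ * x) * eval q x
    eval-linear c₀ c₁ q x = begin
      eval (map (c₀ *_) q +ₚ (0# ∷ (map (c₁ *_) q +ₚ (0# ∷ [])))) x
        ≈⟨ eval-+ₚ (map (c₀ *_) q) _ x ⟩
      eval (map (c₀ *_) q) x + (0# + x * eval (map (c₁ *_) q +ₚ (0# ∷ [])) x)
        ≈⟨ +-cong (eval-scale c₀ q x) (+-congˡ (*-congˡ (eval-+ₚ (map (c₁ *_) q) (0# ∷ []) x))) ⟩
      c₀ * eval q x + (0# + x * (eval (map (c₁ *_) q) x + (0# + x * 0#)))
        ≈⟨ +-congˡ (+-congˡ (*-congˡ (+-congʳ (eval-scale c₁ q x)))) ⟩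
      c₀ * eval q x + (0# + x * (c₁ * eval q x + (0# + x * 0#)))
        ≈⟨ zsolve 4 (λ c₀ c₁ x u → (c₀ :* u :+ (con (+ 0) :+ x :* (c₁ :* u :+ (con (+ 0) :+ x :* con (+ 0)))))
                                    := ((c₀ :+ c₁ :* x) :* u)) refl c₀ c₁ x _ ⟩
      (c₀ + c₁ * x) * eval q x ∎

    eval-cong : ∀ p q → p ≈ₚ q → ∀ x → eval p x ≈ eval q x
    eval-cong []      []      e x = refl
    eval-cong []      (b ∷ q) e x = begin
      0#                ≈⟨ zsolve 1 (λ x → con (+ 0) := (con (+ 0) :+ x :* con (+ 0))) refl x ⟩
      0# + x * 0#       ≈⟨ +-cong (e zero) (*-congˡ (eval-cong [] q (λ k → e (suc k)) x)) ⟩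
      b + x * eval q x  ∎
    eval-cong (a ∷ p) []      e x = begin
      a + x * eval p x  ≈⟨ +-cong (e zero) (*-congˡ (eval-cong p [] (λ k → e (suc k)) x)) ⟩
      0# + x * 0#       ≈⟨ zsolve 1 (λ x → (con (+ 0) :+ x :* con (+ 0)) := con (+ 0)) refl x ⟩
      0#                ∎
    eval-cong (a ∷ p) (b ∷ q) e x = +-cong (e zero) (*-congˡ (eval-cong p q (λ k → e (suc k)) x))

    eval-pointCong : ∀ q {x y} → x ≈ y → eval q x ≈ eval q y
    eval-pointCong []      e = refl
    eval-pointCong (a ∷ q) e = +-congˡ (*-cong e (eval-pointCong q e))

    prodAt : Carrier → List Carrier → Carrier
    prodAt x []       = 1#
    prodAt x (a ∷ as) = (x + - a) * prodAt x as

    eval-linProd : ∀ as x → eval (linProd as) x ≈ prodAt x as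
    eval-linProd []       x = trans (+-congˡ (zeroʳ x)) (+-identityʳ _)
    eval-linProd (a ∷ as) x = begin
      eval ((X- a) *ₚ linProd as) x        ≈⟨ eval-linear (- a) 1# (linProd as) x ⟩
      (- a + 1# * x) * eval (linProd as) x ≈⟨ *-cong (zsolve 2 (λ a x → (:- a :+ con (+ 1) :* x) := (x :+ :- a)) refl a x) (eval-linProd as x) ⟩
      (x + - a) * prodAt x as              ∎

    prodAt-cong : ∀ as bs → linProd as ≈ₚ linProd bs → ∀ x → prodAt x as ≈ prodAt x bs
    prodAt-cong as bs e x = begin
      prodAt x as          ≈⟨ eval-linProd as x ⟨
      eval (linProd as) x  ≈⟨ eval-cong (linProd as) (linProd bs) e x ⟩
      eval (linProd bs) x  ≈⟨ eval-linProd bs x ⟩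
      prodAt x bs          ∎

    linProd-cong : ∀ {as bs} → Pointwise _≈_ as bs → linProd as ≈ₚ linProd bs
    linProd-cong []                    = λ k → refl
    linProd-cong {a ∷ as} {b ∷ bs} (a≈b ∷ e) = X-cong (linProd as) (linProd bs) a≈b (linProd-cong e)

    record SplitOff {p} (P : Carrier → Set p) (g : Carrier → Carrier) (as : List Carrier) : Set (c Level.⊔ ℓ Level.⊔ p) where
      field
        root       : Carrier
        rest       : List Carrier
        property   : P root
        length-rest : suc (length rest) ≡ length as
        product    : linProd as ≈ₚ ((X- root) *ₚ linProd rest)
        sum        : sumOf g as ≈ g root + sumOf g rest

    splitOff : ∀ {p} {P : Carrier → Set p} (g : Carrier → Carrier) (as : List Carrier) → Any P as → SplitOff P g as
    splitOff g (a ∷ as) (here pa) = record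
      { root = a ; rest = as ; property = pa ; length-rest = ≡.refl ; product = λ k → refl ; sum = refl }
    splitOff g (b ∷ as) (there any) = record
      { root = root ; rest = b ∷ rest ; property = property ; length-rest = ≡.cong suc length-rest
      ; product = λ k → trans (X-cong (linProd as) ((X- root) *ₚ linProd rest) refl product k)
                              (X-comm b root (linProd rest) k)
      ; sum = trans (+-congˡ sum) (zsolve 3 (λ x y u → (x :+ (y :+ u)) := (y :+ (x :+ u))) refl (g b) (g root) (sumOf g rest)) }
      where open SplitOff (splitOff g as any)

module OrderedFields where

  open import Defs using (OrderedField; module Poly)
  open import Data.Nat as ℕ using (zero; suc)
  import Data.Nat.Properties as ℕP
  open import Data.Integer as ℤ using (+_; -[1+_])
  import Data.Integer.Properties as ℤP
  open import Data.List using ([]; _∷_)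
  open import Data.List.Relation.Unary.Any using (Any; here; there)
  open import Data.List.Relation.Unary.All using (All; []; _∷_)
  open import Data.Product using (proj₁; proj₂)
  open import Data.Sum using (_⊎_; inj₁; inj₂)
  open import Relation.Nullary using (¬_; yes; no)
  open import Relation.Nullary.Negation using (contradiction; negated-stable; ¬¬-map)
  open import Relation.Binary.PropositionalEquality as ≡ using (_≡_)
  open import Relation.Binary.Definitions using (tri<; tri≈; tri>)
  open IntegerImage
  open Polynomials

  -- Double negation as a monad; the arguments below are constructive, so
  -- facts such as "a product is zero only if a factor is" hold only up to
  -- double negation.  All final conclusions are decidable, hence stable.
  ¬¬-bind : ∀ {a b} {A : Set a} {B : Set b} → ¬ ¬ A → (A → ¬ ¬ B) → ¬ ¬ B
  ¬¬-bind ¬¬a f = negated-stable (¬¬-map f ¬¬a)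

  module Facts {c ℓ₁ ℓ₂} (K : OrderedField c ℓ₁ ℓ₂) where
    open OrderedField K hiding (zero)
    open Poly commutativeRing
    open Canonical commutativeRing
    open Over commutativeRing
    open import Relation.Binary.Reasoning.Setoid setoid
    open import Relation.Binary.Structures using (IsTotalOrder)
    open import Algebra.Properties.Group +-group using (∙-cancelʳ; x∙y⁻¹≈ε⇒x≈y)
    private module TO = IsTotalOrder isTotalOrder

    ≤-respects-≈ : ∀ {x x' y y'} → x ≈ x' → y ≈ y' → x ≤ₒ y → x' ≤ₒ y'
    ≤-respects-≈ e f le = TO.trans (TO.reflexive (sym e)) (TO.trans le (TO.reflexive f))

    square-nonneg : ∀ x → 0# ≤ₒ (x * x)
    square-nonneg x with TO.total 0# x
    ... | inj₁ 0≤x = *-nonneg x x 0≤x 0≤x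
    ... | inj₂ x≤0 = ≤-respects-≈ refl (zsolve 1 (λ x → (:- x :* :- x) := (x :* x)) refl x) (*-nonneg (- x) (- x) 0≤-x 0≤-x)
      where
      0≤-x : 0# ≤ₒ (- x)
      0≤-x = ≤-respects-≈ (-‿inverseʳ x) (+-identityˡ (- x)) (+-mono-≤ₒ x 0# (- x) x≤0)

    +-nonneg : ∀ {a b} → 0# ≤ₒ a → 0# ≤ₒ b → 0# ≤ₒ (a + b)
    +-nonneg {a} {b} 0≤a 0≤b = TO.trans 0≤b (≤-respects-≈ (+-identityˡ b) refl (+-mono-≤ₒ 0# a b 0≤a))

    nonneg-sum-zeroˡ : ∀ {a b} → 0# ≤ₒ a → 0# ≤ₒ b → a + b ≈ 0# → a ≈ 0#
    nonneg-sum-zeroˡ {a} {b} 0≤a 0≤b a+b≈0 =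
      TO.antisym (≤-respects-≈ (+-identityˡ a) (trans (+-comm b a) a+b≈0) (+-mono-≤ₒ 0# b a 0≤b)) 0≤a

    nonneg-sum-zeroʳ : ∀ {a b} → 0# ≤ₒ a → 0# ≤ₒ b → a + b ≈ 0# → b ≈ 0#
    nonneg-sum-zeroʳ 0≤a 0≤b a+b≈0 = nonneg-sum-zeroˡ 0≤b 0≤a (trans (+-comm _ _) a+b≈0)

    0≤1 : 0# ≤ₒ 1#
    0≤1 = ≤-respects-≈ refl (*-identityˡ 1#) (square-nonneg 1#)

    fromℕ-nonneg : ∀ k → 0# ≤ₒ fromℕ k
    fromℕ-nonneg zero    = TO.refl
    fromℕ-nonneg (suc k) = +-nonneg 0≤1 (fromℕ-nonneg k)

    fromℕ-suc≉0 : ∀ k → ¬ (fromℕ (suc k) ≈ 0#)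
    fromℕ-suc≉0 k e = 0≉1 (sym (nonneg-sum-zeroˡ 0≤1 (fromℕ-nonneg k) e))

    +-cancelʳ : ∀ {x y z} → x + z ≈ y + z → x ≈ y
    +-cancelʳ {x} {y} {z} = ∙-cancelʳ z x y

    fromℕ-gap : ∀ {a b} → a ℕ.< b → fromℕ b ≈ fromℕ (suc (b ℕ.∸ suc a)) + fromℕ a
    fromℕ-gap {a} {b} a<b = trans (fromℕ-cong (≡.sym b≡)) (fromℕ-+ (suc (b ℕ.∸ suc a)) a)
      where
      b≡ : suc (b ℕ.∸ suc a) ℕ.+ a ≡ b
      b≡ = ≡.trans (ℕP.+-comm (suc (b ℕ.∸ suc a)) a) (≡.trans (ℕP.+-suc a _) (ℕP.m+[n∸m]≡n a<b))

    fromℕ-<⇒≉ : ∀ {a b} → a ℕ.< b → ¬ (fromℕ a ≈ fromℕ b)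
    fromℕ-<⇒≉ {a} {b} a<b e = fromℕ-suc≉0 (b ℕ.∸ suc a) (sym (+-cancelʳ (begin
      0# + fromℕ a                         ≈⟨ +-identityˡ _ ⟩
      fromℕ a                              ≈⟨ e ⟩
      fromℕ b                              ≈⟨ fromℕ-gap a<b ⟩
      fromℕ (suc (b ℕ.∸ suc a)) + fromℕ a  ∎)))

    fromℕ-injective : ∀ {a b} → fromℕ a ≈ fromℕ b → a ≡ b
    fromℕ-injective {a} {b} e with ℕP.<-cmp a b
    ... | tri< a<b _ _ = contradiction e (fromℕ-<⇒≉ a<b)
    ... | tri≈ _ a≡b _ = a≡b
    ... | tri> _ _ b<a = contradiction (sym e) (fromℕ-<⇒≉ b<a)

    fromℤ≈0⇒≡0 : ∀ i → fromℤ i ≈ 0# → i ≡ + 0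
    fromℤ≈0⇒≡0 (+ zero)  e = ≡.refl
    fromℤ≈0⇒≡0 (+ suc p) e = contradiction e (fromℕ-suc≉0 p)
    fromℤ≈0⇒≡0 -[1+ p ]  e = contradiction (begin
      fromℕ (suc p)     ≈⟨ neg-neg _ ⟨
      - - fromℕ (suc p) ≈⟨ -‿cong e ⟩
      - 0#              ≈⟨ zsolve 0 (:- con (+ 0) := con (+ 0)) refl ⟩
      0#                ∎) (fromℕ-suc≉0 p)

    fromℤ-injective : ∀ {i j} → fromℤ i ≈ fromℤ j → i ≡ j
    fromℤ-injective {i} {j} e = ℤP.i-j≡0⇒i≡j i j (fromℤ≈0⇒≡0 (i ℤ.- j) (begin
      fromℤ (i ℤ.+ ℤ.- j)      ≈⟨ fromℤ-+ i (ℤ.- j) ⟩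
      fromℤ i + fromℤ (ℤ.- j)  ≈⟨ +-cong e (fromℤ-neg j) ⟩
      fromℤ j + - fromℤ j      ≈⟨ -‿inverseʳ _ ⟩
      0#                       ∎))

    nonneg+fromℕ⇒≤ : ∀ {x} a b → 0# ≤ₒ x → x + fromℕ a ≈ fromℕ b → a ℕ.≤ b
    nonneg+fromℕ⇒≤ {x} a b 0≤x e with a ℕ.≤? b
    ... | yes a≤b = a≤b
    ... | no  a≰b = contradiction gap≈0 (fromℕ-suc≉0 d)
      where
      b<a = ℕP.≰⇒> a≰b
      d = a ℕ.∸ suc b
      gap≈0 : fromℕ (suc d) ≈ 0#
      gap≈0 = nonneg-sum-zeroʳ 0≤x (fromℕ-nonneg (suc d)) (+-cancelʳ (begin
        (x + fromℕ (suc d)) + fromℕ b ≈⟨ +-assoc _ _ _ ⟩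
        x + (fromℕ (suc d) + fromℕ b) ≈⟨ +-congˡ (fromℕ-gap b<a) ⟨
        x + fromℕ a                   ≈⟨ e ⟩
        fromℕ b                       ≈⟨ +-identityˡ _ ⟨
        0# + fromℕ b                  ∎))

    +fromℕ-idem⇒zero : ∀ {x} a → x + fromℕ a ≈ fromℕ a → x ≈ 0#
    +fromℕ-idem⇒zero a e = +-cancelʳ (trans e (sym (+-identityˡ _)))

    *-zero⇒factor-zero : ∀ {x y} → x * y ≈ 0# → ¬ ¬ (x ≈ 0# ⊎ y ≈ 0#)
    *-zero⇒factor-zero {x} {y} xy≈0 ¬zero = ¬zero (inj₂ (begin
      y           ≈⟨ *-identityˡ y ⟨
      1# * y      ≈⟨ *-congʳ (proj₂ x⁻¹) ⟨
      (x * z) * y ≈⟨ zsolve 3 (λ x z y → ((x :* z) :* y) := (z :* (x :* y))) refl x z y ⟩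
      z * (x * y) ≈⟨ *-congˡ xy≈0 ⟩
      z * 0#      ≈⟨ zeroʳ z ⟩
      0#          ∎))
      where
      x⁻¹ = inverse x (λ x≈0 → ¬zero (inj₁ x≈0))
      z = proj₁ x⁻¹

    prodAt-zero⇒root : ∀ x as → prodAt x as ≈ 0# → ¬ ¬ Any (λ a → x + - a ≈ 0#) as
    prodAt-zero⇒root x []       e = contradiction (sym e) 0≉1
    prodAt-zero⇒root x (a ∷ as) e = ¬¬-bind (*-zero⇒factor-zero e) λ where
      (inj₁ x-a≈0) → contradiction (here x-a≈0)
      (inj₂ rest≈0) → ¬¬-map there (prodAt-zero⇒root x as rest≈0)

    sumSqDev-nonneg : ∀ c bs → 0# ≤ₒ sumOf (sqDev c) bs
    sumSqDev-nonneg c []       = TO.refl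
    sumSqDev-nonneg c (b ∷ bs) = +-nonneg (square-nonneg (b + - c)) (sumSqDev-nonneg c bs)

    sumSqDev-zero : ∀ c bs → sumOf (sqDev c) bs ≈ 0# → ¬ ¬ All (λ b → b ≈ c) bs
    sumSqDev-zero c []       e = contradiction []
    sumSqDev-zero c (b ∷ bs) e =
      ¬¬-bind (*-zero⇒factor-zero (nonneg-sum-zeroˡ (square-nonneg (b + - c)) (sumSqDev-nonneg c bs) e)) λ b-c≈0 →
      ¬¬-map (λ rest → x∙y⁻¹≈ε⇒x≈y b c (either b-c≈0) ∷ rest)
             (sumSqDev-zero c bs (nonneg-sum-zeroʳ (square-nonneg (b + - c)) (sumSqDev-nonneg c bs) e))
      where
      either : ∀ {u} → u ≈ 0# ⊎ u ≈ 0# → u ≈ 0#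
      either (inj₁ p) = p
      either (inj₂ p) = p

module RootBound where

  open import Defs
  open import Data.Nat as ℕ using (ℕ; zero; suc; _≤_)
  import Data.Nat.Properties as ℕP
  open import Data.Nat.Tactic.RingSolver using (solve-∀)
  open import Data.Integer as ℤ using (ℤ; +_)
  import Data.Integer.Properties as ℤP
  open import Data.List using (List; []; _∷_; map; length; replicate)
  import Data.List.Properties as ListP
  open import Data.List.Relation.Unary.All using (All; []; _∷_)
  open import Data.List.Relation.Binary.Pointwise using (Pointwise; []; _∷_)
  import Data.Vec as Vec
  import Data.Vec.Properties as VecP
  open import Data.Product using (_×_; _,_; proj₁; proj₂)
  open import Relation.Nullary using (¬_)
  open import Relation.Nullary.Decidable using (decidable-stable)
  open import Relation.Nullary.Negation using (¬¬-map)
  open import Relation.Binary.PropositionalEquality as ≡ using (_≡_)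
  open import Function.Bundles using (_⇔_; mk⇔)
  open import Algebra.Bundles using (CommutativeRing)
  import Level
  open IntegerImage
  open Polynomials
  open OrderedFields

  module IntegerPolynomials {c ℓ} (R : CommutativeRing c ℓ) where
    open CommutativeRing R hiding (zero)
    open Poly R
    open Canonical R
    open Over R
    open import Relation.Binary.Reasoning.Setoid setoid
    private module ℤAlg = Over ℤP.+-*-commutativeRing

    image : List ℤ → List Carrier
    image = map fromℤ

    coeff-image : ∀ q k → coeff (image q) k ≈ fromℤ (coeffℤ q k)
    coeff-image []      k       = refl
    coeff-image (a ∷ q) zero    = refl
    coeff-image (a ∷ q) (suc k) = coeff-image q k

    eval-image : ∀ q x → eval (image q) (fromℤ x) ≈ fromℤ (evalℤ q x)
    eval-image []      x = refl
    eval-image (a ∷ q) x = begin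
      fromℤ a + fromℤ x * eval (image q) (fromℤ x) ≈⟨ +-congˡ (*-congˡ (eval-image q x)) ⟩
      fromℤ a + fromℤ x * fromℤ (evalℤ q x)        ≈⟨ +-congˡ (fromℤ-* x (evalℤ q x)) ⟨
      fromℤ a + fromℤ (x ℤ.* evalℤ q x)            ≈⟨ fromℤ-+ a (x ℤ.* evalℤ q x) ⟨
      fromℤ (a ℤ.+ x ℤ.* evalℤ q x)                ∎

    image-X- : ∀ a q → image (linℤ a *ℤ q) ≈ₚ ((X- fromℤ a) *ₚ image q)
    image-X- a q k = begin
      coeff (image (linℤ a *ℤ q)) k
        ≈⟨ coeff-image (linℤ a *ℤ q) k ⟩
      fromℤ (coeffℤ (linℤ a *ℤ q) k)
        ≡⟨ ≡.cong fromℤ (ℤAlg.coeff-linear (ℤ.- a) (+ 1) q k) ⟩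
      fromℤ (ℤ.- a ℤ.* coeffℤ q k ℤ.+ + 1 ℤ.* ℤAlg.coeffShift q k)
        ≈⟨ trans (fromℤ-+ (ℤ.- a ℤ.* coeffℤ q k) (+ 1 ℤ.* ℤAlg.coeffShift q k))
             (+-cong (fromℤ-* (ℤ.- a) (coeffℤ q k)) (fromℤ-* (+ 1) (ℤAlg.coeffShift q k))) ⟩
      fromℤ (ℤ.- a) * fromℤ (coeffℤ q k) + fromℤ (+ 1) * fromℤ (ℤAlg.coeffShift q k)
        ≈⟨ +-cong (*-cong (fromℤ-neg a) (sym (coeff-image q k))) (*-cong (+-identityʳ 1#) (sym (shift k))) ⟩
      - fromℤ a * coeff (image q) k + 1# * coeffShift (image q) k
        ≈⟨ coeff-linear (- fromℤ a) 1# (image q) k ⟨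
      coeff ((X- fromℤ a) *ₚ image q) k ∎
      where
      shift : ∀ k → coeffShift (image q) k ≈ fromℤ (ℤAlg.coeffShift q k)
      shift zero    = refl
      shift (suc k) = coeff-image q k

    image-pow : ∀ a m → image (linℤ a ^ℤ m) ≈ₚ linProd (replicate m (fromℤ a))
    image-pow a zero    zero    = +-identityʳ 1#
    image-pow a zero    (suc k) = refl
    image-pow a (suc m) k = trans (image-X- a (linℤ a ^ℤ m) k)
      (X-cong (image (linℤ a ^ℤ m)) (linProd (replicate m (fromℤ a))) refl (image-pow a m) k)

    target : ℕ → List ℤ
    target m = linℤ (+ 1) *ℤ (linℤ (+ 2) *ℤ (linℤ (+ 3) ^ℤ m))

    targetRoots : ℕ → List Carrier
    targetRoots m = 1# ∷ fromℤ (+ 2) ∷ replicate m (fromℤ (+ 3))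

    image-target : ∀ m → image (target m) ≈ₚ linProd (targetRoots m)
    image-target m k = trans (image-X- (+ 1) (linℤ (+ 2) *ℤ (linℤ (+ 3) ^ℤ m)) k)
      (X-cong (image (linℤ (+ 2) *ℤ (linℤ (+ 3) ^ℤ m))) (linProd (fromℤ (+ 2) ∷ replicate m (fromℤ (+ 3)))) (+-identityʳ 1#)
        (λ k → trans (image-X- (+ 2) (linℤ (+ 3) ^ℤ m) k)
                 (X-cong (image (linℤ (+ 3) ^ℤ m)) (linProd (replicate m (fromℤ (+ 3)))) refl (image-pow (+ 3) m) k)) k)

  module RealRooted {c ℓ₁ ℓ₂} (K : OrderedField c ℓ₁ ℓ₂)
    (p : List ℤ) (r' n t : ℕ)
    (elements      : n ℕ.+ 3 ≡ 3 ℕ.* suc (suc r'))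
    (subleading    : coeffℤ p (suc r') ≡ ℤ.- (+ n))
    (subsubleading : coeffℤ p r' ℤ.+ coeffℤ p r' ℤ.+ + (2 ℕ.* t) ℤ.+ + n ≡ + (n ℕ.* n))
    (root-one      : evalℤ p (+ 1) ≡ + 0)
    (root-two      : evalℤ p (+ 2) ≡ + 0)
    (realRooted    : AllRootsIn K (suc (suc r')) p)
    where

    open OrderedField K hiding (zero)
    open Poly commutativeRing
    open Canonical commutativeRing
    open Over commutativeRing
    open Facts K
    open IntegerPolynomials commutativeRing
    open import Algebra.Properties.Group +-group using (x∙y⁻¹≈ε⇒x≈y)
    open import Relation.Binary.Reasoning.Setoid setoid

    r = suc (suc r')
    R = fromℕ r
    T = fromℕ t
    N = fromℕ n
    one two three : Carrier
    one   = 1#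
    two   = fromℤ (+ 2)
    three = fromℤ (+ 3)

    prodAt-factorisation : ∀ bs → image p ≈ₚ linProd bs → ∀ {x} i → x ≈ fromℤ i → prodAt x bs ≈ fromℤ (evalℤ p i)
    prodAt-factorisation bs e {x} i x≈i = begin
      prodAt x bs                  ≈⟨ eval-linProd bs x ⟨
      eval (linProd bs) x          ≈⟨ eval-cong (linProd bs) (image p) (λ k → sym (e k)) x ⟩
      eval (image p) x             ≈⟨ eval-pointCong (image p) x≈i ⟩
      eval (image p) (fromℤ i)     ≈⟨ eval-image p i ⟩
      fromℤ (evalℤ p i)            ∎

    module _ (bs : List Carrier) (len : length bs ≡ r) (e : image p ≈ₚ linProd bs) where
      sum-roots : sumOf (λ b → b) bs ≈ N
      sum-roots = begin
        sumOf (λ b → b) bs         ≈⟨ neg-neg _ ⟨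
        - - sumOf (λ b → b) bs     ≈⟨ -‿cong (coeff-linProd-e₁ bs (suc r') len) ⟨
        - coeff (linProd bs) (suc r') ≈⟨ -‿cong (e (suc r')) ⟨
        - coeff (image p) (suc r') ≈⟨ -‿cong (trans (coeff-image p (suc r')) (trans (fromℤ-cong subleading) (fromℤ-neg (+ n)))) ⟩
        - - N                      ≈⟨ neg-neg N ⟩
        N                          ∎

      sum-squares : sumOf (λ b → b * b) bs ≈ fromℕ 2 * T + N
      sum-squares = begin
        Q                                   ≈⟨ zsolve 2 (λ s q → q := (s :* s :+ :- (s :* s :+ :- q))) refl S Q ⟩
        S * S + - (S * S + - Q)             ≈⟨ +-cong (*-cong sum-roots sum-roots) (-‿cong (sym (newton₂ bs))) ⟩
        N * N + - (E + E)                   ≈⟨ +-congʳ subsubleading-image ⟨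
        ((E + E) + fromℕ 2 * T + N) + - (E + E)
          ≈⟨ zsolve 3 (λ e t x → ((e :+ e :+ con (+ 2) :* t :+ x) :+ :- (e :+ e)) := (con (+ 2) :* t :+ x)) refl E T N ⟩
        fromℕ 2 * T + N                     ∎
        where
        S = sumOf (λ b → b) bs
        Q = sumOf (λ b → b * b) bs
        E = e₂ bs
        C = coeffℤ p r'
        e₂≈C : E ≈ fromℤ C
        e₂≈C = trans (sym (coeff-linProd-e₂ bs r' len)) (trans (sym (e r')) (coeff-image p r'))
        subsubleading-image : (E + E) + fromℕ 2 * T + N ≈ N * N
        subsubleading-image = begin
          (E + E) + fromℕ 2 * T + N                 ≈⟨ +-congʳ (+-cong (+-cong e₂≈C e₂≈C) (sym (fromℕ-* 2 t))) ⟩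
          (fromℤ C + fromℤ C) + fromℕ (2 ℕ.* t) + N ≈⟨ +-congʳ (+-congʳ (fromℤ-+ C C)) ⟨
          fromℤ (C ℤ.+ C) + fromℕ (2 ℕ.* t) + N     ≈⟨ +-congʳ (fromℤ-+ (C ℤ.+ C) (+ (2 ℕ.* t))) ⟨
          fromℤ (C ℤ.+ C ℤ.+ + (2 ℕ.* t)) + N       ≈⟨ fromℤ-+ (C ℤ.+ C ℤ.+ + (2 ℕ.* t)) (+ n) ⟨
          fromℤ (C ℤ.+ C ℤ.+ + (2 ℕ.* t) ℤ.+ + n)   ≡⟨ ≡.cong fromℤ subsubleading ⟩
          fromℕ (n ℕ.* n)                           ≈⟨ fromℕ-* n n ⟩
          N * N                                     ∎

      -- Σ (bᵢ - 3)² = 2t - 6r + 15, stated without subtraction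
      sumSqDev-roots : sumOf (sqDev three) bs + fromℕ 6 * R ≈ fromℕ 2 * T + fromℕ 15
      sumSqDev-roots = begin
        D + fromℕ 6 * R
          ≈⟨ zsolve 3 (λ d s r → (d :+ con (+ 6) :* r) := ((d :+ (con (+ 3) :+ con (+ 3)) :* s) :+ (:- con (+ 6) :* s :+ con (+ 6) :* r))) refl D S R ⟩
        (D + (three + three) * S) + (- fromℕ 6 * S + fromℕ 6 * R)
          ≈⟨ +-cong (sumSqDev-expand three bs) (+-congʳ (*-congˡ sum-roots)) ⟩
        (sumOf (λ b → b * b) bs + fromℕ (length bs) * (three * three)) + (- fromℕ 6 * N + fromℕ 6 * R)
          ≈⟨ +-congʳ (+-cong sum-squares (*-congʳ (fromℕ-cong len))) ⟩
        ((fromℕ 2 * T + N) + R * (three * three)) + (- fromℕ 6 * N + fromℕ 6 * R)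
          ≈⟨ zsolve 3 (λ t x r → (((con (+ 2) :* t :+ x) :+ r :* (con (+ 3) :* con (+ 3))) :+ (:- con (+ 6) :* x :+ con (+ 6) :* r))
                                := ((con (+ 2) :* t :+ con (+ 15)) :+ con (+ 5) :* (con (+ 3) :* r :+ :- (x :+ con (+ 3))))) refl T N R ⟩
        (fromℕ 2 * T + fromℕ 15) + fromℕ 5 * (fromℕ 3 * R + - (N + fromℕ 3))
          ≈⟨ +-congˡ (*-congˡ (+-congˡ (-‿cong elements-image))) ⟩
        (fromℕ 2 * T + fromℕ 15) + fromℕ 5 * (fromℕ 3 * R + - (fromℕ 3 * R))
          ≈⟨ zsolve 2 (λ t r → ((con (+ 2) :* t :+ con (+ 15)) :+ con (+ 5) :* (con (+ 3) :* r :+ :- (con (+ 3) :* r)))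
                              := (con (+ 2) :* t :+ con (+ 15))) refl T R ⟩
        fromℕ 2 * T + fromℕ 15 ∎
        where
        D = sumOf (sqDev three) bs
        S = sumOf (λ b → b) bs
        elements-image : N + fromℕ 3 ≈ fromℕ 3 * R
        elements-image = trans (sym (fromℕ-+ n 3)) (trans (fromℕ-cong elements) (fromℕ-* 3 r))

    roots : List Carrier
    roots = Vec.toList (proj₁ realRooted)

    length-roots : length roots ≡ r
    length-roots = VecP.length-toList (proj₁ realRooted)

    factorisation : image p ≈ₚ linProd roots
    factorisation = proj₂ realRooted

    record RootsOneTwo : Set (c Level.⊔ ℓ₁) where
      field
        others          : List Carrier
        length-others   : length others ≡ r'
        factors         : image p ≈ₚ linProd (one ∷ two ∷ others)
        sumSqDev-others : sumOf (sqDev three) others + fromℕ (6 ℕ.* r ℕ.+ 5) ≈ fromℕ (2 ℕ.* t ℕ.+ 15)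

    private
      Two = SplitOff (λ a → two + - a ≈ 0#) (sqDev three) roots
      One : List Carrier → Set _
      One = SplitOff (λ b → one + - b ≈ 0#) (sqDev three)

    -- once 2 is split off, 1 is a root of the remaining product since 1 ≠ 2
    rest-vanishes-at-one : (s : Two) → prodAt one (SplitOff.rest s) ≈ 0#
    rest-vanishes-at-one s = begin
      P                               ≈⟨ zsolve 1 (λ x → x := :- ((con (+ 1) :+ :- con (+ 2)) :* x)) refl P ⟩
      - ((one + - two) * P)           ≈⟨ -‿cong (*-congʳ (+-congˡ (-‿cong (x∙y⁻¹≈ε⇒x≈y two root property)))) ⟩
      - ((one + - root) * P)          ≈⟨ -‿cong (prodAt-cong roots (root ∷ rest) product one) ⟨
      - prodAt one roots              ≈⟨ -‿cong (prodAt-factorisation roots factorisation (+ 1) (sym (+-identityʳ 1#))) ⟩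
      - fromℤ (evalℤ p (+ 1))         ≈⟨ -‿cong (fromℤ-cong root-one) ⟩
      - 0#                            ≈⟨ zsolve 0 (:- con (+ 0) := con (+ 0)) refl ⟩
      0#                              ∎
      where
      open SplitOff s
      P = prodAt one rest

    module _ (s₂ : Two) (s₁ : One (SplitOff.rest s₂)) where
      private
        a  = SplitOff.root s₂
        ys = SplitOff.rest s₂
        b  = SplitOff.root s₁
        zs = SplitOff.rest s₁
        a≈two : a ≈ two
        a≈two = sym (x∙y⁻¹≈ε⇒x≈y two a (SplitOff.property s₂))
        b≈one : b ≈ one
        b≈one = sym (x∙y⁻¹≈ε⇒x≈y one b (SplitOff.property s₁))

      split-factors : image p ≈ₚ linProd (one ∷ two ∷ zs)
      split-factors k = begin
        coeff (image p) k                              ≈⟨ factorisation k ⟩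
        coeff (linProd roots) k                        ≈⟨ SplitOff.product s₂ k ⟩
        coeff ((X- a) *ₚ linProd ys) k
          ≈⟨ X-cong (linProd ys) ((X- one) *ₚ linProd zs) a≈two
               (λ k → trans (SplitOff.product s₁ k) (X-cong (linProd zs) (linProd zs) b≈one (λ _ → refl) k)) k ⟩
        coeff ((X- two) *ₚ ((X- one) *ₚ linProd zs)) k ≈⟨ X-comm two one (linProd zs) k ⟩
        coeff (linProd (one ∷ two ∷ zs)) k             ∎

      -- the roots 1 and 2 account for (1-3)² + (2-3)² = 5 of Σ (bᵢ - 3)²
      split-sumSqDev : sumOf (sqDev three) zs + fromℕ (6 ℕ.* r ℕ.+ 5) ≈ fromℕ (2 ℕ.* t ℕ.+ 15)
      split-sumSqDev = begin
        D + fromℕ (6 ℕ.* r ℕ.+ 5)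
          ≈⟨ +-congˡ (trans (fromℕ-+ (6 ℕ.* r) 5) (+-congʳ (fromℕ-* 6 r))) ⟩
        D + (fromℕ 6 * R + fromℕ 5)
          ≈⟨ zsolve 2 (λ d r → (d :+ (con (+ 6) :* r :+ con (+ 5)))
                              := ((((con (+ 2) :+ :- con (+ 3)) :* (con (+ 2) :+ :- con (+ 3)))
                                   :+ (((con (+ 1) :+ :- con (+ 3)) :* (con (+ 1) :+ :- con (+ 3))) :+ d)) :+ con (+ 6) :* r)) refl D R ⟩
        (sqDev three two + (sqDev three one + D)) + fromℕ 6 * R
          ≈⟨ +-congʳ (+-cong (sqDev-cong a≈two) (+-congʳ (sqDev-cong b≈one))) ⟨
        (sqDev three a + (sqDev three b + D)) + fromℕ 6 * R
          ≈⟨ +-congʳ (trans (SplitOff.sum s₂) (+-congˡ (SplitOff.sum s₁))) ⟨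
        sumOf (sqDev three) roots + fromℕ 6 * R        ≈⟨ sumSqDev-roots roots length-roots factorisation ⟩
        fromℕ 2 * T + fromℕ 15                         ≈⟨ trans (fromℕ-+ (2 ℕ.* t) 15) (+-congʳ (fromℕ-* 2 t)) ⟨
        fromℕ (2 ℕ.* t ℕ.+ 15)                         ∎
        where
        D = sumOf (sqDev three) zs
        sqDev-cong : ∀ {x y} → x ≈ y → sqDev three x ≈ sqDev three y
        sqDev-cong e = *-cong (+-congʳ e) (+-congʳ e)

      assemble : RootsOneTwo
      assemble = record
        { others          = zs
        ; length-others   = ℕP.suc-injective (ℕP.suc-injective
                              (≡.trans (≡.cong suc (SplitOff.length-rest s₁)) (≡.trans (SplitOff.length-rest s₂) length-roots)))
        ; factors         = split-factors
        ; sumSqDev-others = split-sumSqDev }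

    rootsOneTwo : ¬ ¬ RootsOneTwo
    rootsOneTwo =
      ¬¬-bind (prodAt-zero⇒root two roots two-root) λ two∈ →
      let s₂ = splitOff (sqDev three) roots two∈ in
      ¬¬-map (λ one∈ → assemble s₂ (splitOff (sqDev three) (SplitOff.rest s₂) one∈))
             (prodAt-zero⇒root one (SplitOff.rest s₂) (rest-vanishes-at-one s₂))
      where
      two-root : prodAt two roots ≈ 0#
      two-root = trans (prodAt-factorisation roots factorisation (+ 2) refl) (fromℤ-cong root-two)

    private
      six-r : 6 ℕ.* r ℕ.+ 5 ≡ 2 ℕ.* (3 ℕ.* r) ℕ.+ 5
      six-r = identity r
        where identity : ∀ x → 6 ℕ.* x ℕ.+ 5 ≡ 2 ℕ.* (3 ℕ.* x) ℕ.+ 5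
              identity = solve-∀

      two-t : 2 ℕ.* t ℕ.+ 15 ≡ 2 ℕ.* (t ℕ.+ 5) ℕ.+ 5
      two-t = identity t
        where identity : ∀ x → 2 ℕ.* x ℕ.+ 15 ≡ 2 ℕ.* (x ℕ.+ 5) ℕ.+ 5
              identity = solve-∀

    halve-≤ : 6 ℕ.* r ℕ.+ 5 ≤ 2 ℕ.* t ℕ.+ 15 → 3 ℕ.* r ≤ t ℕ.+ 5
    halve-≤ le = ℕP.*-cancelˡ-≤ 2 (ℕP.+-cancelʳ-≤ 5 _ _ (≡.subst₂ _≤_ six-r two-t le))

    halve-≡ : 6 ℕ.* r ℕ.+ 5 ≡ 2 ℕ.* t ℕ.+ 15 → t ℕ.+ 5 ≡ 3 ℕ.* r
    halve-≡ eq = ≡.sym (ℕP.*-cancelˡ-≡ (3 ℕ.* r) (t ℕ.+ 5) 2 (ℕP.+-cancelʳ-≡ 5 _ _ (≡.trans (≡.sym six-r) (≡.trans eq two-t))))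

    double-≡ : t ℕ.+ 5 ≡ 3 ℕ.* r → 6 ℕ.* r ℕ.+ 5 ≡ 2 ℕ.* t ℕ.+ 15
    double-≡ eq = ≡.trans six-r (≡.trans (≡.cong (λ m → 2 ℕ.* m ℕ.+ 5) (≡.sym eq)) (≡.sym two-t))

    -- 3r ≤ t + 5: the remaining squared deviations are non-negative
    lower-bound : 3 ℕ.* r ≤ t ℕ.+ 5
    lower-bound = decidable-stable (3 ℕ.* r ℕ.≤? t ℕ.+ 5) (¬¬-map bound rootsOneTwo)
      where
      bound : RootsOneTwo → 3 ℕ.* r ≤ t ℕ.+ 5
      bound d = halve-≤ (nonneg+fromℕ⇒≤ _ _ (sumSqDev-nonneg three others) sumSqDev-others)
        where open RootsOneTwo d

    pointwise-replicate : ∀ {c} bs m → All (λ b → b ≈ c) bs → length bs ≡ m → Pointwise _≈_ bs (replicate m c)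
    pointwise-replicate []       zero    []         _   = []
    pointwise-replicate (b ∷ bs) (suc m) (b≈c ∷ h) len = b≈c ∷ pointwise-replicate bs m h (ℕP.suc-injective len)

    -- equality forces the remaining roots to be 3, hence p = (x-1)(x-2)(x-3)^(r-2)
    extremal⇒target : t ℕ.+ 5 ≡ 3 ℕ.* r → ∀ k → coeffℤ p k ≡ coeffℤ (target r') k
    extremal⇒target eq k = decidable-stable (coeffℤ p k ℤ.≟ coeffℤ (target r') k)
      (¬¬-bind rootsOneTwo λ d → ¬¬-map (coefficients d) (others-are-three d))
      where
      others-are-three : (d : RootsOneTwo) → ¬ ¬ All (λ b → b ≈ three) (RootsOneTwo.others d)
      others-are-three d = sumSqDev-zero three others (+fromℕ-idem⇒zero (6 ℕ.* r ℕ.+ 5)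
        (trans sumSqDev-others (fromℕ-cong (≡.sym (double-≡ eq)))))
        where open RootsOneTwo d

      coefficients : (d : RootsOneTwo) → All (λ b → b ≈ three) (RootsOneTwo.others d) → coeffℤ p k ≡ coeffℤ (target r') k
      coefficients d all-three = fromℤ-injective (begin
        fromℤ (coeffℤ p k)                       ≈⟨ coeff-image p k ⟨
        coeff (image p) k                        ≈⟨ factors k ⟩
        coeff (linProd (one ∷ two ∷ others)) k
          ≈⟨ linProd-cong (refl ∷ refl ∷ pointwise-replicate others r' all-three length-others) k ⟩
        coeff (linProd (targetRoots r')) k       ≈⟨ image-target r' k ⟨
        coeff (image (target r')) k              ≈⟨ coeff-image (target r') k ⟩
        fromℤ (coeffℤ (target r') k)             ∎)
        where open RootsOneTwo d

    sumSqDev-replicate : ∀ m → sumOf (sqDev three) (replicate m three) ≈ 0#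
    sumSqDev-replicate zero    = refl
    sumSqDev-replicate (suc m) = trans (+-congˡ (sumSqDev-replicate m))
      (zsolve 0 (((con (+ 3) :+ :- con (+ 3)) :* (con (+ 3) :+ :- con (+ 3)) :+ con (+ 0)) := con (+ 0)) refl)

    -- conversely, for p = (x-1)(x-2)(x-3)^(r-2) the sum Σ (bᵢ - 3)² is 5
    target⇒extremal : (∀ k → coeffℤ p k ≡ coeffℤ (target r') k) → t ℕ.+ 5 ≡ 3 ℕ.* r
    target⇒extremal same = halve-≡ (fromℕ-injective (begin
      fromℕ (6 ℕ.* r ℕ.+ 5)       ≈⟨ trans (fromℕ-+ (6 ℕ.* r) 5) (+-congʳ (fromℕ-* 6 r)) ⟩
      fromℕ 6 * R + fromℕ 5
        ≈⟨ zsolve 1 (λ r → (con (+ 6) :* r :+ con (+ 5))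
                          := ((((con (+ 1) :+ :- con (+ 3)) :* (con (+ 1) :+ :- con (+ 3)))
                               :+ (((con (+ 2) :+ :- con (+ 3)) :* (con (+ 2) :+ :- con (+ 3))) :+ con (+ 0))) :+ con (+ 6) :* r)) refl R ⟩
      (sqDev three one + (sqDev three two + 0#)) + fromℕ 6 * R
        ≈⟨ +-congʳ (+-congˡ (+-congˡ (sumSqDev-replicate r'))) ⟨
      sumOf (sqDev three) (targetRoots r') + fromℕ 6 * R
        ≈⟨ sumSqDev-roots (targetRoots r') (≡.cong (λ m → suc (suc m)) (ListP.length-replicate r')) image-p ⟩
      fromℕ 2 * T + fromℕ 15      ≈⟨ trans (fromℕ-+ (2 ℕ.* t) 15) (+-congʳ (fromℕ-* 2 t)) ⟨
      fromℕ (2 ℕ.* t ℕ.+ 15)      ∎))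
      where
      image-p : image p ≈ₚ linProd (targetRoots r')
      image-p k = trans (coeff-image p k) (trans (fromℤ-cong (same k)) (trans (sym (coeff-image (target r') k)) (image-target r' k)))

    conclusion : 3 ℕ.* r ≤ t ℕ.+ 5 × ((t ℕ.+ 5 ≡ 3 ℕ.* r) ⇔ (∀ k → coeffℤ p k ≡ coeffℤ (target r') k))
    conclusion = lower-bound , mk⇔ extremal⇒target target⇒extremal

module FiniteSums where

  open import Defs using (sumℤ; subsets; coeffℤ; evalℤ)
  open import Data.Nat as ℕ using (ℕ; zero; suc)
  open import Data.Integer as ℤ using (ℤ; +_)
  import Data.Integer.Properties as ℤP
  open import Data.Integer.Tactic.RingSolver using (solve-∀)
  open import Data.Fin as F using (Fin)
  import Data.Fin.Properties as FinP
  open import Data.Fin.Subset using (Subset; ∣_∣)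
  open import Data.Fin.Subset.Properties using (_∈?_)
  open import Data.Bool using (true; false; if_then_else_)
  open import Data.List as List using (List; []; _∷_; map; filter; _++_)
  import Data.List.Properties as ListP
  open import Data.Vec as Vec using ([]; _∷_)
  import Data.Vec.Properties as VecP
  open import Data.Product using (_×_; _,_; proj₂)
  open import Relation.Nullary using (¬_; Dec; yes; no; does)
  open import Relation.Nullary.Negation using (contradiction)
  import Relation.Nullary.Decidable
  open import Relation.Unary using (Pred; Decidable)
  open import Relation.Binary.PropositionalEquality as ≡ using (_≡_; refl; cong; cong₂; sym; trans)
  open import Algebra.Properties.Semiring.Sum ℤP.+-*-semiring public
    using (sum; sum-cong-≗; ∑-distrib-+; *-distribˡ-sum)

  ind : ∀ {p} {P : Set p} → Dec P → ℤ → ℤ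
  ind d z = if does d then z else + 0

  module _ {p} {P : Set p} where

    ind-yes : ∀ (d : Dec P) {z} → P → ind d z ≡ z
    ind-yes (yes _) _  = refl
    ind-yes (no ¬p) p  = contradiction p ¬p

    ind-no : ∀ (d : Dec P) {z} → ¬ P → ind d z ≡ + 0
    ind-no (yes p) ¬p = contradiction p ¬p
    ind-no (no _)  _  = refl

    ind-0 : ∀ (d : Dec P) → ind d (+ 0) ≡ + 0
    ind-0 (yes _) = refl
    ind-0 (no _)  = refl

    ind-neg : ∀ (d : Dec P) z → ind d (ℤ.- z) ≡ ℤ.- ind d z
    ind-neg (yes _) z = refl
    ind-neg (no _)  z = refl

    ind-sub : ∀ (d : Dec P) a b → ind d (a ℤ.- b) ≡ ind d a ℤ.- ind d b
    ind-sub (yes _) a b = refl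
    ind-sub (no _)  a b = refl

    ind-scale : ∀ (d : Dec P) z → ind d z ≡ z ℤ.* ind d (+ 1)
    ind-scale (yes _) z = sym (ℤP.*-identityʳ z)
    ind-scale (no _)  z = sym (ℤP.*-zeroʳ z)

    ind-idem : ∀ (d : Dec P) z → ind d (ind d z) ≡ ind d z
    ind-idem (yes _) z = refl
    ind-idem (no _)  z = refl

    ind-not : ∀ (d : Dec P) → ind (Relation.Nullary.Decidable.¬? d) (+ 1) ≡ + 1 ℤ.- ind d (+ 1)
    ind-not (yes _) = refl
    ind-not (no _)  = refl

    ind-iff : ∀ {q} {Q : Set q} (d : Dec P) (e : Dec Q) z → (P → Q) → (Q → P) → ind d z ≡ ind e z
    ind-iff (yes _) (yes _) z f g = refl
    ind-iff (yes p) (no ¬q) z f g = contradiction (f p) ¬q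
    ind-iff (no ¬p) (yes q) z f g = contradiction (g q) ¬p
    ind-iff (no _)  (no _)  z f g = refl

  ind₂-zero : ∀ {p q} {P : Set p} {Q : Set q} (d : Dec P) (e : Dec Q) z → ¬ (P × Q) → ind d (ind e z) ≡ + 0
  ind₂-zero (yes p) (yes q) z h = contradiction (p , q) h
  ind₂-zero (yes p) (no _)  z h = refl
  ind₂-zero (no _)  e       z h = refl

  sum-filter : ∀ {a p} {A : Set a} {P : Pred A p} (P? : Decidable P) (g : A → ℤ) (L : List A) →
               sumℤ (map g (filter P? L)) ≡ sumℤ (map (λ x → ind (P? x) (g x)) L)
  sum-filter P? g [] = refl
  sum-filter P? g (x ∷ L) with does (P? x)
  ... | true  = cong (λ w → g x ℤ.+ w) (sum-filter P? g L)
  ... | false = trans (sum-filter P? g L) (sym (ℤP.+-identityˡ _))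

  length-filter : ∀ {a p} {A : Set a} {P : Pred A p} (P? : Decidable P) (L : List A) →
                  + List.length (filter P? L) ≡ sumℤ (map (λ x → ind (P? x) (+ 1)) L)
  length-filter P? [] = refl
  length-filter P? (x ∷ L) with does (P? x)
  ... | true  = trans (ℤP.pos-+ 1 _) (cong (λ w → + 1 ℤ.+ w) (length-filter P? L))
  ... | false = trans (length-filter P? L) (sym (ℤP.+-identityˡ _))

  sumℤ-++ : ∀ (xs ys : List ℤ) → sumℤ (xs ++ ys) ≡ sumℤ xs ℤ.+ sumℤ ys
  sumℤ-++ []       ys = sym (ℤP.+-identityˡ _)
  sumℤ-++ (x ∷ xs) ys = trans (cong (λ w → x ℤ.+ w) (sumℤ-++ xs ys)) (sym (ℤP.+-assoc x _ _))

  ΣF : ∀ n → (Fin n → ℤ) → ℤ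
  ΣF n = sum {n}

  ΣF-cong : ∀ n {f g : Fin n → ℤ} → (∀ i → f i ≡ g i) → ΣF n f ≡ ΣF n g
  ΣF-cong n = sum-cong-≗ {n}

  ΣS : ∀ n → (Subset n → ℤ) → ℤ
  ΣS zero    f = f []
  ΣS (suc n) f = ΣS n (λ X → f (true ∷ X)) ℤ.+ ΣS n (λ X → f (false ∷ X))

  sum-subsets : ∀ n (f : Subset n → ℤ) → sumℤ (map f (subsets n)) ≡ ΣS n f
  sum-subsets zero    f = ℤP.+-identityʳ _
  sum-subsets (suc n) f = begin
    sumℤ (map f (map (true ∷_) (subsets n) ++ map (false ∷_) (subsets n)))
      ≡⟨ cong sumℤ (ListP.map-++ f (map (true ∷_) (subsets n)) _) ⟩
    sumℤ (map f (map (true ∷_) (subsets n)) ++ map f (map (false ∷_) (subsets n)))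
      ≡⟨ sumℤ-++ (map f (map (true ∷_) (subsets n))) _ ⟩
    sumℤ (map f (map (true ∷_) (subsets n))) ℤ.+ sumℤ (map f (map (false ∷_) (subsets n)))
      ≡⟨ cong₂ ℤ._+_ (cong sumℤ (sym (ListP.map-∘ (subsets n)))) (cong sumℤ (sym (ListP.map-∘ (subsets n)))) ⟩
    sumℤ (map (λ X → f (true ∷ X)) (subsets n)) ℤ.+ sumℤ (map (λ X → f (false ∷ X)) (subsets n))
      ≡⟨ cong₂ ℤ._+_ (sum-subsets n _) (sum-subsets n _) ⟩
    ΣS (suc n) f ∎
    where open ≡.≡-Reasoning

  private
    swap-middle : ∀ a b c d → (a ℤ.+ b) ℤ.+ (c ℤ.+ d) ≡ (a ℤ.+ c) ℤ.+ (b ℤ.+ d)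
    swap-middle = solve-∀

  ΣS-cong : ∀ n {f g : Subset n → ℤ} → (∀ X → f X ≡ g X) → ΣS n f ≡ ΣS n g
  ΣS-cong zero    e = e _
  ΣS-cong (suc n) e = cong₂ ℤ._+_ (ΣS-cong n (λ X → e _)) (ΣS-cong n (λ X → e _))

  ΣS-+ : ∀ n (f g : Subset n → ℤ) → ΣS n (λ X → f X ℤ.+ g X) ≡ ΣS n f ℤ.+ ΣS n g
  ΣS-+ zero    f g = refl
  ΣS-+ (suc n) f g = trans
    (cong₂ ℤ._+_ (ΣS-+ n (λ X → f (true ∷ X)) (λ X → g (true ∷ X))) (ΣS-+ n (λ X → f (false ∷ X)) (λ X → g (false ∷ X))))
    (swap-middle (ΣS n (λ X → f (true ∷ X))) (ΣS n (λ X → g (true ∷ X))) (ΣS n (λ X → f (false ∷ X))) (ΣS n (λ X → g (false ∷ X))))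

  ΣS-zero : ∀ n (f : Subset n → ℤ) → (∀ X → f X ≡ + 0) → ΣS n f ≡ + 0
  ΣS-zero zero    f e = e []
  ΣS-zero (suc n) f e = cong₂ ℤ._+_ (ΣS-zero n _ (λ X → e _)) (ΣS-zero n _ (λ X → e _))

  ΣS-point : ∀ n (f : Subset n → ℤ) (A : Subset n) → (∀ X → ¬ X ≡ A → f X ≡ + 0) → ΣS n f ≡ f A
  ΣS-point zero    f []        e = refl
  ΣS-point (suc n) f (true ∷ A) e = trans
    (cong₂ ℤ._+_ (ΣS-point n _ A (λ X X≢A → e _ (λ eq → X≢A (proj₂ (VecP.∷-injective eq)))))
                 (ΣS-zero n _ (λ X → e _ (λ ()))))
    (ℤP.+-identityʳ _)
  ΣS-point (suc n) f (false ∷ A) e = trans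
    (cong₂ ℤ._+_ (ΣS-zero n _ (λ X → e _ (λ ())))
                 (ΣS-point n _ A (λ X X≢A → e _ (λ eq → X≢A (proj₂ (VecP.∷-injective eq))))))
    (ℤP.+-identityˡ _)

  ΣS-single : ∀ n (A : Subset n) (_≟_ : ∀ X Y → Dec (X ≡ Y)) z → ΣS n (λ X → ind (X ≟ A) z) ≡ z
  ΣS-single n A _≟_ z = trans (ΣS-point n _ A (λ X X≢A → ind-no (X ≟ A) X≢A)) (ind-yes (A ≟ A) refl)

  ΣS-ind : ∀ {p} {P : Set p} (d : Dec P) n (f : Subset n → ℤ) → ΣS n (λ X → ind d (f X)) ≡ ind d (ΣS n f)
  ΣS-ind (yes _) n f = refl
  ΣS-ind (no _)  n f = ΣS-zero n _ (λ _ → refl)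

  ΣS-ΣF : ∀ n m (f : Subset n → Fin m → ℤ) → ΣS n (λ X → ΣF m (f X)) ≡ ΣF m (λ e → ΣS n (λ X → f X e))
  ΣS-ΣF n zero    f = ΣS-zero n _ (λ _ → refl)
  ΣS-ΣF n (suc m) f = trans (ΣS-+ n _ _) (cong (λ w → ΣS n (λ X → f X F.zero) ℤ.+ w) (ΣS-ΣF n m (λ X e → f X (F.suc e))))

  ΣS-list : ∀ {a} {A : Set a} n (L : List A) (f : A → Subset n → ℤ) →
            sumℤ (map (λ k → ΣS n (f k)) L) ≡ ΣS n (λ X → sumℤ (map (λ k → f k X) L))
  ΣS-list n []      f = sym (ΣS-zero n _ (λ _ → refl))
  ΣS-list n (k ∷ L) f = trans (cong (λ w → ΣS n (f k) ℤ.+ w) (ΣS-list n L f)) (sym (ΣS-+ n _ _))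

  ΣF-zero : ∀ n (f : Fin n → ℤ) → (∀ i → f i ≡ + 0) → ΣF n f ≡ + 0
  ΣF-zero zero    f e = refl
  ΣF-zero (suc n) f e = cong₂ ℤ._+_ (e F.zero) (ΣF-zero n _ (λ i → e (F.suc i)))

  ΣF-point : ∀ n (f : Fin n → ℤ) (a : Fin n) → (∀ i → ¬ i ≡ a → f i ≡ + 0) → ΣF n f ≡ f a
  ΣF-point (suc n) f F.zero    e = trans (cong (λ w → f F.zero ℤ.+ w) (ΣF-zero n _ (λ i → e _ (λ ())))) (ℤP.+-identityʳ _)
  ΣF-point (suc n) f (F.suc a) e = trans
    (cong₂ ℤ._+_ (e F.zero (λ ())) (ΣF-point n _ a (λ i i≢a → e _ (λ eq → i≢a (FinP.suc-injective eq)))))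
    (ℤP.+-identityˡ _)

  ΣF-const : ∀ n z → ΣF n (λ _ → z) ≡ + n ℤ.* z
  ΣF-const zero    z = sym (ℤP.*-zeroˡ z)
  ΣF-const (suc n) z = trans (cong (λ w → z ℤ.+ w) (ΣF-const n z)) (identity (+ n) z)
    where
    identity : ∀ m z → z ℤ.+ m ℤ.* z ≡ (+ 1 ℤ.+ m) ℤ.* z
    identity = solve-∀

  ΣF-neg : ∀ n (f : Fin n → ℤ) → ΣF n (λ i → ℤ.- f i) ≡ ℤ.- ΣF n f
  ΣF-neg zero    f = refl
  ΣF-neg (suc n) f = trans (cong (λ w → ℤ.- f F.zero ℤ.+ w) (ΣF-neg n (λ i → f (F.suc i))))
                            (sym (ℤP.neg-distrib-+ (f F.zero) _))

  ΣF-sub : ∀ n (f g : Fin n → ℤ) → ΣF n (λ i → f i ℤ.- g i) ≡ ΣF n f ℤ.- ΣF n g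
  ΣF-sub n f g = trans (∑-distrib-+ f (λ i → ℤ.- g i)) (cong (λ w → ΣF n f ℤ.+ w) (ΣF-neg n g))

  ΣF-ind : ∀ {p} {P : Set p} (d : Dec P) n (f : Fin n → ℤ) → ΣF n (λ i → ind d (f i)) ≡ ind d (ΣF n f)
  ΣF-ind (yes _) n f = refl
  ΣF-ind (no _)  n f = ΣF-zero n _ (λ _ → refl)

  card-ΣF : ∀ {n} (X : Subset n) → + ∣ X ∣ ≡ ΣF n (λ e → ind (e ∈? X) (+ 1))
  card-ΣF []          = refl
  card-ΣF (true ∷ X)  = trans (ℤP.pos-+ 1 ∣ X ∣) (cong (λ w → + 1 ℤ.+ w) (card-ΣF X))
  card-ΣF (false ∷ X) = trans (card-ΣF X) (sym (ℤP.+-identityˡ _))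

  sumℤ-upTo : ∀ (g : ℕ → ℤ) m → sumℤ (map g (List.upTo m)) ≡ ΣF m (λ i → g (F.toℕ i))
  sumℤ-upTo g m = go (λ i → i) m
    where
    go : ∀ (h : ℕ → ℕ) m → sumℤ (map g (List.applyUpTo h m)) ≡ ΣF m (λ i → g (h (F.toℕ i)))
    go h zero    = refl
    go h (suc m) = cong (λ w → g (h 0) ℤ.+ w) (go (λ i → h (suc i)) m)

  coeff-upTo : ∀ (g : ℕ → ℤ) m k → k ℕ.< m → coeffℤ (map g (List.upTo m)) k ≡ g k
  coeff-upTo g m k k<m = go (λ i → i) m k k<m
    where
    go : ∀ (h : ℕ → ℕ) m k → k ℕ.< m → coeffℤ (map g (List.applyUpTo h m)) k ≡ g (h k)
    go h (suc m) zero    _          = refl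
    go h (suc m) (suc k) (ℕ.s≤s lt) = go (λ i → h (suc i)) m k lt

  evalℤ-one : ∀ p → evalℤ p (+ 1) ≡ sumℤ p
  evalℤ-one []      = refl
  evalℤ-one (a ∷ p) = cong (λ w → a ℤ.+ w) (trans (ℤP.*-identityˡ _) (evalℤ-one p))

module MatroidBasics where

  open import Defs
  open import Data.Nat as ℕ using (ℕ; zero; suc; _≤_; _<_; z≤n; s≤s)
  import Data.Nat.Properties as ℕP
  open import Data.Fin using (Fin)
  import Data.Fin.Properties as FinP
  open import Data.Fin.Subset
  open import Data.Fin.Subset.Properties
  open import Data.Bool using (true)
  open import Data.List as List using (List; []; _∷_; filter)
  import Data.List.Membership.Propositional as List
  open import Data.List.Membership.Propositional.Properties using (∈-filter⁺; ∈-filter⁻; ∈-allFin)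
  open import Data.List.Relation.Unary.All as All using (All; []; _∷_)
  open import Data.List.Relation.Unary.Any using (here; there)
  import Data.Vec as Vec
  import Data.Vec.Properties as VecP
  open import Data.Product using (Σ; _×_; _,_; proj₁; proj₂)
  open import Data.Sum using (inj₁; inj₂)
  open import Relation.Nullary using (¬_; Dec; yes; no; does)
  open import Relation.Nullary.Negation using (contradiction)
  open import Relation.Nullary.Decidable using (dec-true; ¬?; _×-dec_)
  open import Relation.Binary.PropositionalEquality as ≡ using (_≡_; refl; cong; sym; trans; subst)

  ∪⊆ : ∀ {n} {A B C : Subset n} → A ⊆ C → B ⊆ C → A ∪ B ⊆ C
  ∪⊆ {A = A} {B} A⊆C B⊆C x∈ with x∈p∪q⁻ A B x∈
  ... | inj₁ x∈A = A⊆C x∈A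
  ... | inj₂ x∈B = B⊆C x∈B

  single⊆ : ∀ {n} {x : Fin n} {X} → x ∈ X → ⁅ x ⁆ ⊆ X
  single⊆ {x = x} {X} x∈X y∈ = subst (_∈ X) (sym (x∈⁅y⁆⇒x≡y x y∈)) x∈X

  ⊆∧≢⇒⊂ : ∀ {n} {A B : Subset n} → A ⊆ B → ¬ A ≡ B → A ⊂ B
  ⊆∧≢⇒⊂ {A = A} {B} A⊆B A≢B with FinP.any? (λ x → (x ∈? B) ×-dec ¬? (x ∈? A))
  ... | yes (x , x∈B , x∉A) = A⊆B , x , x∈B , x∉A
  ... | no none = contradiction (⊆-antisym A⊆B B⊆A) A≢B
    where
    B⊆A : B ⊆ A
    B⊆A {x} x∈B with x ∈? A
    ... | yes x∈A = x∈A
    ... | no  x∉A = contradiction (x , x∈B , x∉A) none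

  ⊂⇒≢ : ∀ {n} {A B : Subset n} → A ⊂ B → ¬ A ≡ B
  ⊂⇒≢ (_ , x , x∈B , x∉A) refl = x∉A x∈B

  card≥1 : ∀ {n} {X : Subset n} {x} → x ∈ X → 1 ≤ ∣ X ∣
  card≥1 {x = x} x∈X = ℕP.≤-trans (ℕP.≤-reflexive (sym (∣⁅x⁆∣≡1 x))) (p⊆q⇒∣p∣≤∣q∣ (single⊆ x∈X))

  _≟S_ : ∀ {n} → (X Y : Subset n) → Dec (X ≡ Y)
  _≟S_ = VecP.≡-dec Data.Bool._≟_
    where import Data.Bool

  twoElements : ∀ {n} {X : Subset n} → 2 ≤ ∣ X ∣ → Σ (Fin n) λ e → Σ (Fin n) λ f → e ∈ X × f ∈ X × ¬ e ≡ f
  twoElements {n} {X} 2≤∣X∣ with nonempty? X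
  ... | no ¬ne = contradiction (ℕP.≤-trans 2≤∣X∣ (ℕP.≤-reflexive (trans (cong ∣_∣ (Empty-unique ¬ne)) (∣⊥∣≡0 n)))) λ ()
  ... | yes (e , e∈X) with FinP.any? (λ f → (f ∈? X) ×-dec ¬? (f FinP.≟ e))
  ...   | yes (f , f∈X , f≢e) = e , f , e∈X , f∈X , λ e≡f → f≢e (sym e≡f)
  ...   | no  none = contradiction (ℕP.≤-trans 2≤∣X∣ (ℕP.≤-trans (p⊆q⇒∣p∣≤∣q∣ X⊆⁅e⁆) (ℕP.≤-reflexive (∣⁅x⁆∣≡1 e)))) λ { (s≤s ()) }
    where
    X⊆⁅e⁆ : X ⊆ ⁅ e ⁆
    X⊆⁅e⁆ {x} x∈X with x FinP.≟ e
    ... | yes refl = x∈⁅x⁆ e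
    ... | no  x≢e  = contradiction (x , x∈X , x≢e) none

  module Closure {n : ℕ} (M : Matroid n) where
    open Matroid M

    rk-≡ : ∀ {A B} → A ⊆ B → B ⊆ A → rk A ≡ rk B
    rk-≡ A⊆B B⊆A = ℕP.≤-antisym (rk-mono _ _ A⊆B) (rk-mono _ _ B⊆A)

    cl : Subset n → Subset n
    cl X = Vec.tabulate (λ e → does (rk (X ∪ ⁅ e ⁆) ℕ.≟ rk X))

    ∈cl⁺ : ∀ {X e} → rk (X ∪ ⁅ e ⁆) ≡ rk X → e ∈ cl X
    ∈cl⁺ {X} {e} h = VecP.lookup⇒[]= e (cl X) (trans (VecP.lookup∘tabulate _ e) (dec-true (rk (X ∪ ⁅ e ⁆) ℕ.≟ rk X) h))

    ∈cl⁻ : ∀ {X e} → e ∈ cl X → rk (X ∪ ⁅ e ⁆) ≡ rk X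
    ∈cl⁻ {X} {e} e∈ = from-does (rk (X ∪ ⁅ e ⁆) ℕ.≟ rk X) (trans (sym (VecP.lookup∘tabulate _ e)) (VecP.[]=⇒lookup e∈))
      where
      from-does : (d : Dec (rk (X ∪ ⁅ e ⁆) ≡ rk X)) → does d ≡ true → rk (X ∪ ⁅ e ⁆) ≡ rk X
      from-does (yes p) _ = p
      from-does (no _)  ()

    X⊆cl : ∀ X → X ⊆ cl X
    X⊆cl X {e} e∈X = ∈cl⁺ (rk-≡ (∪⊆ ⊆-refl (single⊆ e∈X)) (p⊆p∪q ⁅ e ⁆))

    -- submodularity: two extensions of X of the same rank have a union of that rank
    union-same-rank : ∀ X Y Z → X ⊆ Y → X ⊆ Z → rk Y ≡ rk X → rk Z ≡ rk X → rk (Y ∪ Z) ≤ rk X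
    union-same-rank X Y Z X⊆Y X⊆Z rkY rkZ = ℕP.+-cancelʳ-≤ (rk X) (rk (Y ∪ Z)) (rk X) (ℕP.≤-trans
      (ℕP.+-monoʳ-≤ (rk (Y ∪ Z)) (rk-mono X (Y ∩ Z) (λ x∈ → x∈p∩q⁺ (X⊆Y x∈ , X⊆Z x∈))))
      (ℕP.≤-trans (rk-submod Y Z) (ℕP.≤-reflexive (≡.cong₂ ℕ._+_ rkY rkZ))))

    points : List (Fin n) → Subset n
    points ys = ⋃ (List.map ⁅_⁆ ys)

    ∈points : ∀ {y ys} → y List.∈ ys → y ∈ points ys
    ∈points {ys = z ∷ ys} (here refl) = x∈p∪q⁺ (inj₁ (x∈⁅x⁆ z))
    ∈points {ys = z ∷ ys} (there y∈)  = x∈p∪q⁺ (inj₂ (∈points y∈))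

    rk-∪points : ∀ X ys → All (λ y → rk (X ∪ ⁅ y ⁆) ≡ rk X) ys → rk (X ∪ points ys) ≡ rk X
    rk-∪points X []       []       = rk-≡ (∪⊆ ⊆-refl ⊥⊆) (p⊆p∪q ⊥)
    rk-∪points X (y ∷ ys) (h ∷ hs) = ℕP.≤-antisym
      (ℕP.≤-trans (rk-mono _ _ regroup)
        (union-same-rank X (X ∪ points ys) (X ∪ ⁅ y ⁆) (p⊆p∪q (points ys)) (p⊆p∪q ⁅ y ⁆) (rk-∪points X ys hs) h))
      (rk-mono _ _ (p⊆p∪q (points (y ∷ ys))))
      where
      regroup : X ∪ points (y ∷ ys) ⊆ (X ∪ points ys) ∪ (X ∪ ⁅ y ⁆)
      regroup = ∪⊆ (λ x∈ → x∈p∪q⁺ (inj₁ (x∈p∪q⁺ (inj₁ x∈))))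
                   (∪⊆ (λ x∈ → x∈p∪q⁺ (inj₂ (x∈p∪q⁺ (inj₂ x∈)))) (λ x∈ → x∈p∪q⁺ (inj₁ (x∈p∪q⁺ (inj₂ x∈)))))

    -- cl X has the rank of X: it lies in X together with its own elements
    rk-cl : ∀ X → rk (cl X) ≡ rk X
    rk-cl X = ℕP.≤-antisym
      (ℕP.≤-trans (rk-mono _ _ cl⊆) (ℕP.≤-reflexive (rk-∪points X ys in-closure)))
      (rk-mono _ _ (X⊆cl X))
      where
      ys = filter (_∈? cl X) (List.allFin n)
      in-closure : All (λ y → rk (X ∪ ⁅ y ⁆) ≡ rk X) ys
      in-closure = All.tabulate (λ y∈ → ∈cl⁻ (proj₂ (∈-filter⁻ (_∈? cl X) {xs = List.allFin n} y∈)))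
      cl⊆ : cl X ⊆ X ∪ points ys
      cl⊆ {e} e∈ = x∈p∪q⁺ (inj₂ (∈points (∈-filter⁺ (_∈? cl X) (∈-allFin e) e∈)))

    cl-flat : ∀ X → IsFlat M (cl X)
    cl-flat X e e∉ with rk (cl X) ℕ.<? rk (cl X ∪ ⁅ e ⁆)
    ... | yes lt = lt
    ... | no  ≮ = contradiction (∈cl⁺ (ℕP.≤-antisym
            (ℕP.≤-trans (rk-mono _ _ (∪⊆ (λ x∈ → x∈p∪q⁺ (inj₁ (X⊆cl X x∈))) (q⊆p∪q (cl X) ⁅ e ⁆)))
                        (ℕP.≤-trans (ℕP.≮⇒≥ ≮) (ℕP.≤-reflexive (rk-cl X))))
            (rk-mono _ _ (p⊆p∪q ⁅ e ⁆)))) e∉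

    flat⊂⇒rk< : ∀ {F Z} → IsFlat M F → F ⊂ Z → rk F ℕ.< rk Z
    flat⊂⇒rk< flat (F⊆Z , x , x∈Z , x∉F) = ℕP.≤-trans (flat x x∉F) (rk-mono _ _ (∪⊆ F⊆Z (single⊆ x∈Z)))

    flat-unique : ∀ {F X} → IsFlat M F → X ⊆ F → rk F ≡ rk X → F ≡ cl X
    flat-unique {F} {X} flat X⊆F rkF = ⊆-antisym F⊆cl cl⊆F
      where
      F⊆cl : F ⊆ cl X
      F⊆cl {x} x∈F = ∈cl⁺ (ℕP.≤-antisym (ℕP.≤-trans (rk-mono _ _ (∪⊆ X⊆F (single⊆ x∈F))) (ℕP.≤-reflexive rkF))
                                        (rk-mono _ _ (p⊆p∪q ⁅ x ⁆)))
      cl⊆F : cl X ⊆ F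
      cl⊆F {x} x∈ with x ∈? F
      ... | yes x∈F = x∈F
      ... | no  x∉F = contradiction (flat x x∉F) (ℕP.≤⇒≯ (ℕP.≤-trans
              (rk-mono (F ∪ ⁅ x ⁆) (F ∪ (X ∪ ⁅ x ⁆)) (∪⊆ (p⊆p∪q (X ∪ ⁅ x ⁆)) (λ y∈ → x∈p∪q⁺ (inj₂ (x∈p∪q⁺ (inj₂ y∈))))))
              (ℕP.≤-trans (union-same-rank X F (X ∪ ⁅ x ⁆) X⊆F (p⊆p∪q ⁅ x ⁆) rkF (∈cl⁻ x∈)) (ℕP.≤-reflexive (sym rkF)))))

  module Simple {n : ℕ} (M : Matroid n) (simple : IsSimple M) where
    open Matroid M
    open Closure M

    rk-∅ : rk ⊥ ≡ 0
    rk-∅ = ℕP.n≤0⇒n≡0 (ℕP.≤-trans (rk-card ⊥) (ℕP.≤-reflexive (∣⊥∣≡0 n)))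

    rk-point : ∀ e → rk ⁅ e ⁆ ≡ 1
    rk-point e = ℕP.≤-antisym (ℕP.≤-trans (rk-card _) (ℕP.≤-reflexive (∣⁅x⁆∣≡1 e))) (ℕP.n≢0⇒n>0 (proj₁ simple e))

    rk-nonempty : ∀ {X x} → x ∈ X → 1 ≤ rk X
    rk-nonempty {X} {x} x∈X = ℕP.≤-trans (ℕP.≤-reflexive (sym (rk-point x))) (rk-mono _ _ (single⊆ x∈X))

    pair : Fin n → Fin n → Subset n
    pair e f = ⁅ e ⁆ ∪ ⁅ f ⁆

    pair⊆ : ∀ {e f X} → e ∈ X → f ∈ X → pair e f ⊆ X
    pair⊆ e∈X f∈X = ∪⊆ (single⊆ e∈X) (single⊆ f∈X)

    rk-pair : ∀ {e f} → ¬ e ≡ f → rk (pair e f) ≡ 2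
    rk-pair {e} {f} e≢f = ℕP.≤-antisym rk≤2 (ℕP.≮⇒≥ (proj₂ simple e f e≢f))
      where
      rk≤2 : rk (pair e f) ≤ 2
      rk≤2 = ℕP.m+n≤o⇒m≤o (rk (pair e f)) (ℕP.≤-trans (rk-submod ⁅ e ⁆ ⁅ f ⁆)
               (ℕP.≤-reflexive (≡.cong₂ ℕ._+_ (rk-point e) (rk-point f))))

    rk-two-points : ∀ {X} → 2 ≤ ∣ X ∣ → 2 ≤ rk X
    rk-two-points 2≤∣X∣ with twoElements 2≤∣X∣
    ... | e , f , e∈X , f∈X , e≢f = ℕP.≤-trans (ℕP.≤-reflexive (sym (rk-pair e≢f))) (rk-mono _ _ (pair⊆ e∈X f∈X))

    rank0⇒empty : ∀ {X} → rk X ≡ 0 → X ≡ ⊥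
    rank0⇒empty {X} rk0 with nonempty? X
    ... | yes (x , x∈X) = contradiction (sym rk0) (ℕP.<⇒≢ (rk-nonempty x∈X))
    ... | no  ¬ne      = Empty-unique ¬ne

    rank1⇒point : ∀ {X} → rk X ≡ 1 → Σ (Fin n) λ e → X ≡ ⁅ e ⁆
    rank1⇒point {X} rk1 with nonempty? X
    ... | no ¬ne = contradiction (trans (sym rk1) (trans (cong rk (Empty-unique ¬ne)) rk-∅)) λ ()
    ... | yes (e , e∈X) = e , ⊆-antisym X⊆⁅e⁆ (single⊆ e∈X)
      where
      X⊆⁅e⁆ : X ⊆ ⁅ e ⁆
      X⊆⁅e⁆ {f} f∈X with f FinP.≟ e
      ... | yes refl = x∈⁅x⁆ e
      ... | no  f≢e  = contradiction (ℕP.≤-trans (ℕP.≤-reflexive (sym (rk-pair (λ e≡f → f≢e (sym e≡f)))))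
                                        (ℕP.≤-trans (rk-mono _ _ (pair⊆ e∈X f∈X)) (ℕP.≤-reflexive rk1))) λ { (s≤s ()) }

    ∅-flat : IsFlat M ⊥
    ∅-flat e _ = ℕP.≤-trans (s≤s (ℕP.≤-reflexive rk-∅))
                   (ℕP.≤-trans (ℕP.≤-reflexive (sym (rk-point e))) (rk-mono _ _ (q⊆p∪q ⊥ ⁅ e ⁆)))

    point-flat : ∀ e → IsFlat M ⁅ e ⁆
    point-flat e f f∉ = ℕP.≤-trans (s≤s (ℕP.≤-reflexive (rk-point e)))
                          (ℕP.≤-reflexive (sym (rk-pair {e} {f} (λ e≡f → x∉⁅y⁆⇒x≢y f∉ (sym e≡f)))))

    full-flat : IsFlat M ⊤
    full-flat e e∉ = contradiction ∈⊤ e∉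

    line-through : ∀ {e f} → ¬ e ≡ f → IsLine M (cl (pair e f))
    line-through e≢f = cl-flat _ , trans (rk-cl _) (rk-pair e≢f)

    line-unique : ∀ {L e f} → IsLine M L → e ∈ L → f ∈ L → ¬ e ≡ f → L ≡ cl (pair e f)
    line-unique (flat , rk2) e∈L f∈L e≢f = flat-unique flat (pair⊆ e∈L f∈L) (trans rk2 (sym (rk-pair e≢f)))

    small-independent : ∀ D → ∣ D ∣ ≤ 2 → IsIndependent M D
    small-independent D ∣D∣≤2 = ℕP.≤-antisym (rk-card D) (lower ∣ D ∣ refl ∣D∣≤2)
      where
      lower : ∀ k → ∣ D ∣ ≡ k → k ≤ 2 → k ≤ rk D
      lower zero                _   _ = z≤n
      lower (suc zero)          eq  _ with nonempty? D
      ... | yes (x , x∈D) = rk-nonempty x∈D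
      ... | no  ¬ne       = contradiction (trans (sym eq) (trans (cong ∣_∣ (Empty-unique ¬ne)) (∣⊥∣≡0 n))) λ ()
      lower (suc (suc zero))    eq  _ = rk-two-points (ℕP.≤-reflexive (sym eq))
      lower (suc (suc (suc k))) _   (s≤s (s≤s ()))

    module ShortLines (short : ∀ X → IsLine M X → ∣ X ∣ ≤ 3) where

      triangle⇒line : ∀ {C} → ∣ C ∣ ≡ 3 → IsCircuit M C → IsLine M C
      triangle⇒line {C} ∣C∣≡3 (dependent , _) = flat , rk2
        where
        rk2 : rk C ≡ 2
        rk2 = ℕP.≤-antisym (ℕP.≤-pred (ℕP.≤-trans (ℕP.≤∧≢⇒< (rk-card C) dependent) (ℕP.≤-reflexive ∣C∣≡3)))
                           (rk-two-points (ℕP.≤-trans (s≤s (s≤s z≤n)) (ℕP.≤-reflexive (sym ∣C∣≡3))))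
        flat : IsFlat M C
        flat e e∉C with rk C ℕ.<? rk (C ∪ ⁅ e ⁆)
        ... | yes lt = lt
        ... | no  ≮  = contradiction (short (cl C) (cl-flat C , trans (rk-cl C) rk2)) (ℕP.<⇒≱ bigger)
          where
          e∈cl : e ∈ cl C
          e∈cl = ∈cl⁺ (ℕP.≤-antisym (ℕP.≮⇒≥ ≮) (rk-mono _ _ (p⊆p∪q ⁅ e ⁆)))
          bigger : 3 < ∣ cl C ∣
          bigger = ℕP.≤-trans (s≤s (ℕP.≤-reflexive (sym ∣C∣≡3))) (p⊂q⇒∣p∣<∣q∣ (X⊆cl C , e , e∈cl , e∉C))

      -- conversely a three-point line is a circuit: it is dependent and its
      -- proper subsets have at most two elements
      line⇒triangle : ∀ {C} → ∣ C ∣ ≡ 3 → IsLine M C → IsCircuit M C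
      line⇒triangle {C} ∣C∣≡3 (_ , rk2) = dependent , proper-independent
        where
        dependent : ¬ IsIndependent M C
        dependent indep = contradiction (trans (sym rk2) (trans indep ∣C∣≡3)) λ ()
        proper-independent : ∀ D → D ⊂ C → IsIndependent M D
        proper-independent D D⊂C = small-independent D (ℕP.≤-pred (ℕP.≤-trans (p⊂q⇒∣p∣<∣q∣ D⊂C) (ℕP.≤-reflexive ∣C∣≡3)))

module Moebius where

  open import Defs
  open import Data.Nat as ℕ using (ℕ; zero; suc; _≤_; s≤s)
  import Data.Nat.Properties as ℕP
  open import Data.Integer as ℤ using (ℤ; +_)
  open import Data.Integer.Tactic.RingSolver using (solve-∀)
  open import Data.Fin using (Fin)
  open import Data.Fin.Subset
  open import Data.Fin.Subset.Properties
  import Data.List.Properties as ListP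
  open import Data.Product using (Σ; _×_; _,_; proj₁; proj₂)
  open import Relation.Nullary using (¬_; Dec; yes; no)
  open import Relation.Nullary.Negation using (contradiction)
  open import Relation.Binary.PropositionalEquality as ≡ using (_≡_; refl; cong; sym; trans; subst)
  open FiniteSums
  open MatroidBasics

  module Values {n : ℕ} (M : Matroid n) where
    open Matroid M

    μ : Subset n → ℤ
    μ = mu M

    Σflat⊂ : Subset n → (Subset n → ℤ) → ℤ
    Σflat⊂ X g = ΣS n (λ Y → ind (isFlat? M Y) (ind (Y ⊂? X) (g Y)))

    muF-fuel : ∀ k k' X → ∣ X ∣ ≤ k → ∣ X ∣ ≤ k' → muF M k X ≡ muF M k' X
    muF-fuel zero    zero     X _     _     = refl
    muF-fuel zero    (suc k') X ∣X∣≤0 _     with nonempty? X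
    ... | yes (x , x∈X) = contradiction (ℕP.≤-trans (card≥1 x∈X) ∣X∣≤0) λ ()
    ... | no _          = refl
    muF-fuel (suc k) zero     X _     ∣X∣≤0 with nonempty? X
    ... | yes (x , x∈X) = contradiction (ℕP.≤-trans (card≥1 x∈X) ∣X∣≤0) λ ()
    ... | no _          = refl
    muF-fuel (suc k) (suc k') X ∣X∣≤k ∣X∣≤k' with nonempty? X
    ... | no _  = refl
    ... | yes _ = cong ℤ.-_ (trans (sum-filter (_⊂? X) (muF M k) (flats M))
                    (trans (cong sumℤ (ListP.map-cong same-below (flats M)))
                           (sym (sum-filter (_⊂? X) (muF M k') (flats M)))))
      where
      below : ∀ {Y m} → Y ⊂ X → ∣ X ∣ ≤ suc m → ∣ Y ∣ ≤ m
      below Y⊂X ∣X∣≤ = ℕP.≤-pred (ℕP.≤-trans (p⊂q⇒∣p∣<∣q∣ Y⊂X) ∣X∣≤)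
      same-below : ∀ Y → ind (Y ⊂? X) (muF M k Y) ≡ ind (Y ⊂? X) (muF M k' Y)
      same-below Y with Y ⊂? X
      ... | yes Y⊂X = muF-fuel k k' Y (below Y⊂X ∣X∣≤k) (below Y⊂X ∣X∣≤k')
      ... | no _    = refl

    mu-rec : ∀ X → Nonempty X → μ X ≡ ℤ.- Σflat⊂ X μ
    mu-rec X ne = trans (muF-fuel n (suc n) X (∣p∣≤n X) (ℕP.m≤n⇒m≤1+n (∣p∣≤n X))) (unfold ne)
      where
      unfold : Nonempty X → muF M (suc n) X ≡ ℤ.- Σflat⊂ X μ
      unfold ne with nonempty? X
      ... | no ¬ne = contradiction ne ¬ne
      ... | yes _  = cong ℤ.-_ (trans (sum-filter (_⊂? X) μ (flats M))
                       (trans (sum-filter (isFlat? M) (λ Y → ind (Y ⊂? X) (μ Y)) (subsets n)) (sum-subsets n _)))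

    mu-∅ : μ ⊥ ≡ + 1
    mu-∅ = empty n
      where
      empty : ∀ k → muF M k ⊥ ≡ + 1
      empty zero    = refl
      empty (suc k) with nonempty? (⊥ {n})
      ... | yes (x , x∈⊥) = contradiction x∈⊥ ∉⊥
      ... | no _          = refl

  module SimpleValues {n : ℕ} (M : Matroid n) (simple : IsSimple M) where
    open Matroid M
    open Values M
    open Closure M
    open Simple M simple

    private
      -1ℤ : ℤ
      -1ℤ = ℤ.- (+ 1)

    ∅⊂ : ∀ {X : Subset n} {x} → x ∈ X → ⊥ ⊂ X
    ∅⊂ x∈X = ⊥⊆ , _ , x∈X , ∉⊥

    ⊂point⇒∅ : ∀ {Y : Subset n} {e} → Y ⊂ ⁅ e ⁆ → Y ≡ ⊥
    ⊂point⇒∅ {Y} {e} (Y⊆ , x , x∈⁅e⁆ , x∉Y) = Empty-unique λ where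
      (y , y∈Y) → x∉Y (subst (_∈ Y) (trans (x∈⁅y⁆⇒x≡y e (Y⊆ y∈Y)) (sym (x∈⁅y⁆⇒x≡y e x∈⁅e⁆))) y∈Y)

    point-injective : ∀ {e f : Fin n} → ⁅ e ⁆ ≡ ⁅ f ⁆ → e ≡ f
    point-injective {e} {f} eq = x∈⁅y⁆⇒x≡y f (subst (e ∈_) eq (x∈⁅x⁆ e))

    ∅≢point : ∀ {e : Fin n} → ¬ (⊥ ≡ ⁅ e ⁆)
    ∅≢point {e} eq = ∉⊥ (subst (e ∈_) (sym eq) (x∈⁅x⁆ e))

    -- the only flat below a point is ∅
    mu-point : ∀ e → μ ⁅ e ⁆ ≡ -1ℤ
    mu-point e = trans (mu-rec ⁅ e ⁆ (e , x∈⁅x⁆ e)) (cong ℤ.-_ (trans (ΣS-point n _ ⊥ only-∅) value-at-∅))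
      where
      only-∅ : ∀ Y → ¬ Y ≡ ⊥ → ind (isFlat? M Y) (ind (Y ⊂? ⁅ e ⁆) (μ Y)) ≡ + 0
      only-∅ Y Y≢∅ = trans (cong (ind (isFlat? M Y)) (ind-no (Y ⊂? ⁅ e ⁆) (λ Y⊂ → Y≢∅ (⊂point⇒∅ Y⊂)))) (ind-0 (isFlat? M Y))
      value-at-∅ : ind (isFlat? M ⊥) (ind (⊥ ⊂? ⁅ e ⁆) (μ ⊥)) ≡ + 1
      value-at-∅ = trans (ind-yes (isFlat? M ⊥) ∅-flat) (trans (ind-yes (⊥ ⊂? ⁅ e ⁆) (∅⊂ (x∈⁅x⁆ e))) mu-∅)

    -- the flats strictly below a line L are ∅ and the points of L, so
    -- μ(L) = -(1 - |L|)
    module _ {L : Subset n} (line : IsLine M L) where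

      L-has-two : Σ (Fin n) λ e → Σ (Fin n) λ f → e ∈ L × f ∈ L × ¬ e ≡ f
      L-has-two = twoElements (ℕP.≤-trans (ℕP.≤-reflexive (sym (proj₂ line))) (rk-card L))

      belowLine : Subset n → ℤ
      belowLine Y = ind (Y ≟S ⊥) (+ 1) ℤ.+ ΣF n (λ e → ind (e ∈? L) (ind (Y ≟S ⁅ e ⁆) -1ℤ))

      belowLine-∅ : belowLine ⊥ ≡ + 1
      belowLine-∅ = ≡.cong₂ ℤ._+_ (ind-yes (⊥ {n} ≟S ⊥) refl)
        (ΣF-zero n _ λ e → ind₂-zero (e ∈? L) (⊥ ≟S ⁅ e ⁆) -1ℤ λ (_ , ∅≡e) → ∅≢point ∅≡e)

      belowLine-point : ∀ {e} → e ∈ L → belowLine ⁅ e ⁆ ≡ -1ℤ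
      belowLine-point {e} e∈L = trans
        (≡.cong₂ ℤ._+_ (ind-no (⁅ e ⁆ ≟S ⊥) (λ e≡∅ → ∅≢point (sym e≡∅)))
                       (ΣF-point n _ e λ f f≢e → ind₂-zero (f ∈? L) (⁅ e ⁆ ≟S ⁅ f ⁆) -1ℤ λ (_ , e≡f) → f≢e (sym (point-injective e≡f))))
        (trans (ℤ.+-identityˡ _) (trans (ind-yes (e ∈? L) e∈L) (ind-yes (⁅ e ⁆ ≟S ⁅ e ⁆) refl)))
        where import Data.Integer.Properties as ℤ

      belowLine-elsewhere : ∀ Y → ¬ (IsFlat M Y × Y ⊂ L) → belowLine Y ≡ + 0
      belowLine-elsewhere Y not-below = ≡.cong₂ ℤ._+_
        (ind-no (Y ≟S ⊥) λ where refl → not-below (∅-flat , ∅⊂ (proj₁ (proj₂ (proj₂ (proj₂ L-has-two))))))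
        (ΣF-zero n _ λ e → ind₂-zero (e ∈? L) (Y ≟S ⁅ e ⁆) -1ℤ λ where
          (e∈L , refl) → not-below (point-flat e , ⊆∧≢⇒⊂ (single⊆ e∈L) λ e≡L → contradiction (trans (sym (rk-point e)) (trans (cong rk e≡L) (proj₂ line))) λ ()))

      mu-belowLine : ∀ Y → ind (isFlat? M Y) (ind (Y ⊂? L) (μ Y)) ≡ belowLine Y
      mu-belowLine Y = by-cases (isFlat? M Y) (Y ⊂? L)
        where
        below : IsFlat M Y → Y ⊂ L → μ Y ≡ belowLine Y
        below flat Y⊂L with rk Y in rkY | flat⊂⇒rk< flat Y⊂L
        ... | zero        | _ = subst (λ Z → μ Z ≡ belowLine Z) (sym (rank0⇒empty rkY)) (trans mu-∅ (sym belowLine-∅))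
        ... | suc zero    | _ with rank1⇒point rkY
        ...   | e , refl = trans (mu-point e) (sym (belowLine-point (proj₁ Y⊂L (x∈⁅x⁆ e))))
        below flat Y⊂L | suc (suc _) | rk<2 = contradiction (ℕP.≤-trans rk<2 (ℕP.≤-reflexive (proj₂ line))) λ { (s≤s (s≤s ())) }

        by-cases : (d₁ : Dec (IsFlat M Y)) (d₂ : Dec (Y ⊂ L)) → ind d₁ (ind d₂ (μ Y)) ≡ belowLine Y
        by-cases (no ¬flat) _          = sym (belowLine-elsewhere Y λ (flat , _) → ¬flat flat)
        by-cases (yes _)    (no ¬Y⊂L)  = sym (belowLine-elsewhere Y λ (_ , Y⊂L) → ¬Y⊂L Y⊂L)
        by-cases (yes flat) (yes Y⊂L)  = below flat Y⊂L

      sum-belowLine : ΣS n belowLine ≡ + 1 ℤ.- + ∣ L ∣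
      sum-belowLine = begin
        ΣS n belowLine
          ≡⟨ ΣS-+ n _ _ ⟩
        ΣS n (λ Y → ind (Y ≟S ⊥) (+ 1)) ℤ.+ ΣS n (λ Y → ΣF n (λ e → ind (e ∈? L) (ind (Y ≟S ⁅ e ⁆) -1ℤ)))
          ≡⟨ ≡.cong₂ ℤ._+_ (ΣS-single n ⊥ _≟S_ (+ 1)) (ΣS-ΣF n n (λ Y e → ind (e ∈? L) (ind (Y ≟S ⁅ e ⁆) -1ℤ))) ⟩
        + 1 ℤ.+ ΣF n (λ e → ΣS n (λ Y → ind (e ∈? L) (ind (Y ≟S ⁅ e ⁆) -1ℤ)))
          ≡⟨ cong (λ w → + 1 ℤ.+ w) (ΣF-cong n λ e → trans (ΣS-ind (e ∈? L) n _) (cong (ind (e ∈? L)) (ΣS-single n ⁅ e ⁆ _≟S_ -1ℤ))) ⟩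
        + 1 ℤ.+ ΣF n (λ e → ind (e ∈? L) -1ℤ)
          ≡⟨ cong (λ w → + 1 ℤ.+ w) (trans (ΣF-cong n (λ e → ind-neg (e ∈? L) (+ 1))) (trans (ΣF-neg n _) (cong ℤ.-_ (sym (card-ΣF L))))) ⟩
        + 1 ℤ.- + ∣ L ∣ ∎
        where open ≡.≡-Reasoning

      mu-line : μ L ≡ + ∣ L ∣ ℤ.- + 1
      mu-line = trans (mu-rec L (_ , proj₁ (proj₂ (proj₂ L-has-two))))
                  (trans (cong ℤ.-_ (trans (ΣS-cong n mu-belowLine) sum-belowLine)) (negate (+ ∣ L ∣)))
        where
        negate : ∀ x → ℤ.- (+ 1 ℤ.- x) ≡ x ℤ.- + 1
        negate = solve-∀

module CharPoly where

  open import Defs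
  open import Data.Nat as ℕ using (ℕ; suc; _≤_; s≤s)
  import Data.Nat.Properties as ℕP
  open import Data.Integer as ℤ using (ℤ; +_)
  import Data.Integer.Properties as ℤP
  open import Data.Integer.Tactic.RingSolver using (solve-∀)
  open import Data.Fin as F using (Fin)
  import Data.Fin.Properties as FinP
  open import Data.Fin.Subset
  open import Data.Fin.Subset.Properties
  import Data.List as List
  import Data.List.Properties as ListP
  open import Data.Product using (_×_; _,_; proj₁; proj₂)
  open import Data.Sum using (inj₁; inj₂)
  open import Relation.Nullary using (¬_; Dec; yes; no)
  open import Relation.Nullary.Negation using (contradiction)
  open import Relation.Nullary.Decidable using (¬?; _×-dec_)
  open import Relation.Binary.PropositionalEquality as ≡ using (_≡_; refl; cong; cong₂; sym; trans)
  open FiniteSums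
  open MatroidBasics
  open Moebius

  module Coefficients {n : ℕ} (M : Matroid n) (simple : IsSimple M) where
    open Matroid M
    open Closure M
    open Simple M simple
    open Values M
    open SimpleValues M simple

    r = rank M

    whitney : ℕ → Subset n → ℤ
    whitney k X = ind (isFlat? M X) (ind (rk X ℕ.+ k ℕ.≟ r) (μ X))

    -- chiCoeff is Whitney's sum, as M has no loops
    chiCoeff-whitney : ∀ k → chiCoeff M k ≡ ΣS n (whitney k)
    chiCoeff-whitney k with FinP.any? (λ e → rk ⁅ e ⁆ ℕ.≟ 0)
    ... | yes (e , loop) = contradiction loop (proj₁ simple e)
    ... | no _ = trans (sum-filter (λ X → rk X ℕ.+ k ℕ.≟ r) μ (flats M))
                   (trans (sum-filter (isFlat? M) (λ X → ind (rk X ℕ.+ k ℕ.≟ r) (μ X)) (subsets n)) (sum-subsets n _))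

    chiPoly-coeff : ∀ k → k ≤ r → coeffℤ (chiPoly M) k ≡ chiCoeff M k
    chiPoly-coeff k k≤r = coeff-upTo (chiCoeff M) (suc r) k (s≤s k≤r)

    -- the flats of rank 1 are the n points, each with μ = -1
    chiCoeff-corank1 : ∀ k → suc k ≡ r → chiCoeff M k ≡ ℤ.- (+ n)
    chiCoeff-corank1 k 1+k≡r = begin
      chiCoeff M k                                       ≡⟨ chiCoeff-whitney k ⟩
      ΣS n (whitney k)                                   ≡⟨ ΣS-cong n (λ X → as-points X (isFlat? M X) (rk X ℕ.+ k ℕ.≟ r)) ⟩
      ΣS n (λ X → ΣF n (λ e → ind (X ≟S ⁅ e ⁆) -1ℤ))    ≡⟨ ΣS-ΣF n n (λ X e → ind (X ≟S ⁅ e ⁆) -1ℤ) ⟩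
      ΣF n (λ e → ΣS n (λ X → ind (X ≟S ⁅ e ⁆) -1ℤ))    ≡⟨ ΣF-cong n (λ e → ΣS-single n ⁅ e ⁆ _≟S_ -1ℤ) ⟩
      ΣF n (λ _ → -1ℤ)                                   ≡⟨ ΣF-const n -1ℤ ⟩
      + n ℤ.* -1ℤ                                        ≡⟨ times-minus-one (+ n) ⟩
      ℤ.- (+ n)                                          ∎
      where
      open ≡.≡-Reasoning
      -1ℤ = ℤ.- (+ 1)
      times-minus-one : ∀ x → x ℤ.* ℤ.- (+ 1) ≡ ℤ.- x
      times-minus-one = solve-∀
      as-points : ∀ X (d₁ : Dec (IsFlat M X)) (d₂ : Dec (rk X ℕ.+ k ≡ r)) →
                  ind d₁ (ind d₂ (μ X)) ≡ ΣF n (λ e → ind (X ≟S ⁅ e ⁆) -1ℤ)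
      as-points X (yes flat) (yes rank-ok) with rank1⇒point {X} (ℕP.+-cancelʳ-≡ k (rk X) 1 (trans rank-ok (sym 1+k≡r)))
      ... | e , refl = trans (mu-point e) (sym (trans
              (ΣF-point n _ e (λ f f≢e → ind-no (⁅ e ⁆ ≟S ⁅ f ⁆) (λ e≡f → f≢e (sym (point-injective e≡f)))))
              (ind-yes (⁅ e ⁆ ≟S ⁅ e ⁆) refl)))
      as-points X (yes _) (no wrong-rank) = sym (ΣF-zero n _ λ e → ind-no (X ≟S ⁅ e ⁆) λ where
        refl → wrong-rank (trans (cong (ℕ._+ k) (rk-point e)) 1+k≡r))
      as-points X (no ¬flat) _ = sym (ΣF-zero n _ λ e → ind-no (X ≟S ⁅ e ⁆) λ where
        refl → ¬flat (point-flat e))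

    chiPoly-corank1 : ∀ k → suc k ≡ r → coeffℤ (chiPoly M) k ≡ ℤ.- (+ n)
    chiPoly-corank1 k 1+k≡r = trans (chiPoly-coeff k (ℕP.≤-trans (ℕP.n≤1+n k) (ℕP.≤-reflexive 1+k≡r))) (chiCoeff-corank1 k 1+k≡r)

    -- each flat X contributes to exactly one coefficient, that of λ^(r - rk X)
    sum-whitney : ∀ X → sumℤ (List.map (λ k → whitney k X) (List.upTo (suc r))) ≡ ind (isFlat? M X) (μ X)
    sum-whitney X = begin
      sumℤ (List.map (λ k → whitney k X) (List.upTo (suc r)))
        ≡⟨ sumℤ-upTo (λ k → whitney k X) (suc r) ⟩
      ΣF (suc r) (λ i → ind (isFlat? M X) (term i))
        ≡⟨ ΣF-ind (isFlat? M X) (suc r) term ⟩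
      ind (isFlat? M X) (ΣF (suc r) term)
        ≡⟨ cong (ind (isFlat? M X)) (trans (ΣF-point (suc r) term corank off) (ind-yes (rk X ℕ.+ F.toℕ corank ℕ.≟ r) on)) ⟩
      ind (isFlat? M X) (μ X) ∎
      where
      open ≡.≡-Reasoning
      term : Fin (suc r) → ℤ
      term i = ind (rk X ℕ.+ F.toℕ i ℕ.≟ r) (μ X)
      corank : Fin (suc r)
      corank = F.fromℕ< (s≤s (ℕP.m∸n≤m r (rk X)))
      on : rk X ℕ.+ F.toℕ corank ≡ r
      on = trans (cong (rk X ℕ.+_) (FinP.toℕ-fromℕ< _)) (ℕP.m+[n∸m]≡n (rk-mono X ⊤ ⊆⊤))
      off : ∀ i → ¬ i ≡ corank → term i ≡ + 0
      off i i≢ = ind-no (rk X ℕ.+ F.toℕ i ℕ.≟ r) λ eq → i≢ (FinP.toℕ-injective (ℕP.+-cancelˡ-≡ (rk X) _ _ (trans eq (sym on))))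

    split-top : ∀ X → ind (isFlat? M X) (μ X) ≡ ind (X ≟S ⊤) (μ ⊤) ℤ.+ ind (isFlat? M X) (ind (X ⊂? ⊤) (μ X))
    split-top X = by-cases (X ≟S ⊤) (X ⊂? ⊤)
      where
      by-cases : (d : Dec (X ≡ ⊤)) (d' : Dec (X ⊂ ⊤)) →
                 ind (isFlat? M X) (μ X) ≡ ind d (μ ⊤) ℤ.+ ind (isFlat? M X) (ind d' (μ X))
      by-cases (yes refl) d' = trans (ind-yes (isFlat? M ⊤) full-flat) (sym (trans
        (cong (λ w → μ ⊤ ℤ.+ w) (trans (cong (ind (isFlat? M ⊤)) (ind-no d' (λ ⊤⊂⊤ → ⊂⇒≢ ⊤⊂⊤ refl))) (ind-0 (isFlat? M ⊤))))
        (ℤP.+-identityʳ _)))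
      by-cases (no X≢⊤) d' = sym (trans (ℤP.+-identityˡ _) (cong (ind (isFlat? M X)) (ind-yes d' (⊆∧≢⇒⊂ ⊆⊤ X≢⊤))))

    -- χ(1) = Σ_{flats X} μ(X) = μ(E) + Σ_{flats X ⊂ E} μ(X) = 0
    chi-one : 1 ≤ r → evalℤ (chiPoly M) (+ 1) ≡ + 0
    chi-one 1≤r = begin
      evalℤ (chiPoly M) (+ 1)                                     ≡⟨ evalℤ-one (chiPoly M) ⟩
      sumℤ (chiPoly M)                                            ≡⟨ cong sumℤ (ListP.map-cong chiCoeff-whitney (List.upTo (suc r))) ⟩
      sumℤ (List.map (λ k → ΣS n (whitney k)) (List.upTo (suc r))) ≡⟨ ΣS-list n (List.upTo (suc r)) whitney ⟩
      ΣS n (λ X → sumℤ (List.map (λ k → whitney k X) (List.upTo (suc r))))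
        ≡⟨ ΣS-cong n (λ X → trans (sum-whitney X) (split-top X)) ⟩
      ΣS n (λ X → ind (X ≟S ⊤) (μ ⊤) ℤ.+ ind (isFlat? M X) (ind (X ⊂? ⊤) (μ X)))
        ≡⟨ ΣS-+ n _ _ ⟩
      ΣS n (λ X → ind (X ≟S ⊤) (μ ⊤)) ℤ.+ Σflat⊂ ⊤ μ              ≡⟨ cong (λ w → w ℤ.+ Σflat⊂ ⊤ μ) (trans (ΣS-single n ⊤ _≟S_ (μ ⊤)) (mu-rec ⊤ E-nonempty)) ⟩
      ℤ.- Σflat⊂ ⊤ μ ℤ.+ Σflat⊂ ⊤ μ                                ≡⟨ ℤP.+-inverseˡ (Σflat⊂ ⊤ μ) ⟩
      + 0                                                          ∎
      where
      open ≡.≡-Reasoning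
      E-nonempty : Nonempty (⊤ {n})
      E-nonempty with nonempty? (⊤ {n})
      ... | yes ne  = ne
      ... | no  ¬ne = contradiction (ℕP.≤-trans 1≤r (ℕP.≤-reflexive (trans (cong rk (Empty-unique ¬ne)) rk-∅))) λ ()

    distinct : Fin n → Fin n → ℤ
    distinct e f = ind (¬? (e FinP.≟ f)) (+ 1)

    ordered-pairs : ∀ X → ΣF n (λ e → ΣF n (λ f → ind (e ∈? X) (ind (f ∈? X) (distinct e f))))
                          ≡ + ∣ X ∣ ℤ.* + ∣ X ∣ ℤ.- + ∣ X ∣
    ordered-pairs X = trans (ΣF-cong n pairs-from) (trans (ΣF-sub n _ _)
        (cong₂ ℤ._-_ (trans (ΣF-cong n (λ e → ind-scale (e ∈? X) c)) (trans (sym (*-distribˡ-sum c (λ e → ind (e ∈? X) (+ 1)))) (cong (c ℤ.*_) (sym (card-ΣF X)))))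
                     (sym (card-ΣF X))))
      where
      c = + ∣ X ∣
      others : ∀ e → ΣF n (λ f → ind (f ∈? X) (distinct e f)) ≡ c ℤ.- ind (e ∈? X) (+ 1)
      others e = trans (ΣF-cong n (λ f → trans (cong (ind (f ∈? X)) (ind-not (e FinP.≟ f))) (ind-sub (f ∈? X) (+ 1) _)))
                 (trans (ΣF-sub n _ _) (cong₂ ℤ._-_ (sym (card-ΣF X))
                   (trans (ΣF-point n _ e (λ f f≢e → trans (cong (ind (f ∈? X)) (ind-no (e FinP.≟ f) (λ e≡f → f≢e (sym e≡f)))) (ind-0 (f ∈? X))))
                          (cong (ind (e ∈? X)) (ind-yes (e FinP.≟ e) refl)))))
      pairs-from : ∀ e → ΣF n (λ f → ind (e ∈? X) (ind (f ∈? X) (distinct e f))) ≡ ind (e ∈? X) c ℤ.- ind (e ∈? X) (+ 1)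
      pairs-from e = trans (ΣF-ind (e ∈? X) n _) (trans (cong (ind (e ∈? X)) (others e))
                       (trans (ind-sub (e ∈? X) c _) (cong (λ w → ind (e ∈? X) c ℤ.- w) (ind-idem (e ∈? X) (+ 1)))))

    onLine : Fin n → Fin n → Subset n → ℤ
    onLine e f X = ind (isFlat? M X) (ind (rk X ℕ.≟ 2) (ind (e ∈? X) (ind (f ∈? X) (distinct e f))))

    lines-through : ∀ e f → ΣS n (onLine e f) ≡ distinct e f
    lines-through e f = by-cases (e FinP.≟ f)
      where
      onLine′ : Dec (e ≡ f) → Subset n → ℤ
      onLine′ d X = ind (isFlat? M X) (ind (rk X ℕ.≟ 2) (ind (e ∈? X) (ind (f ∈? X) (ind (¬? d) (+ 1)))))

      by-cases : (d : Dec (e ≡ f)) → ΣS n (onLine′ d) ≡ ind (¬? d) (+ 1)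
      by-cases (yes _)   = ΣS-zero n _ (λ X → trans
        (cong (λ w → ind (isFlat? M X) (ind (rk X ℕ.≟ 2) w)) (trans (cong (ind (e ∈? X)) (ind-0 (f ∈? X))) (ind-0 (e ∈? X))))
        (trans (cong (ind (isFlat? M X)) (ind-0 (rk X ℕ.≟ 2))) (ind-0 (isFlat? M X))))
      by-cases (no e≢f) = trans (ΣS-point n _ L off-line) on-line
        where
        L = cl (pair e f)
        e∈L : e ∈ L
        e∈L = X⊆cl _ (x∈p∪q⁺ (inj₁ (x∈⁅x⁆ e)))
        f∈L : f ∈ L
        f∈L = X⊆cl _ (x∈p∪q⁺ (inj₂ (x∈⁅x⁆ f)))
        on-line : onLine′ (no e≢f) L ≡ + 1
        on-line = trans (ind-yes (isFlat? M L) (proj₁ (line-through e≢f))) (trans (ind-yes (rk L ℕ.≟ 2) (proj₂ (line-through e≢f)))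
                  (trans (ind-yes (e ∈? L) e∈L) (ind-yes (f ∈? L) f∈L)))
        off-line : ∀ X → ¬ X ≡ L → onLine′ (no e≢f) X ≡ + 0
        off-line X X≢L = by-cases′ (isFlat? M X) (rk X ℕ.≟ 2) (e ∈? X) (f ∈? X)
          where
          by-cases′ : (d₁ : Dec (IsFlat M X)) (d₂ : Dec (rk X ≡ 2)) (d₃ : Dec (e ∈ X)) (d₄ : Dec (f ∈ X)) →
                      ind d₁ (ind d₂ (ind d₃ (ind d₄ (+ 1)))) ≡ + 0
          by-cases′ (yes flat) (yes rk2) (yes e∈X) (yes f∈X) = contradiction (line-unique (flat , rk2) e∈X f∈X e≢f) X≢L
          by-cases′ (yes _)    (yes _)   (yes _)   (no _)    = refl
          by-cases′ (yes _)    (yes _)   (no _)    _         = refl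
          by-cases′ (yes _)    (no _)    _         _         = refl
          by-cases′ (no _)     _         _         _         = refl

    pairsOnLine : Subset n → ℤ
    pairsOnLine X = ΣF n (λ e → ΣF n (λ f → onLine e f X))

    pairsOnLine-card : ∀ X → pairsOnLine X ≡ ind (isFlat? M X) (ind (rk X ℕ.≟ 2) (+ ∣ X ∣ ℤ.* + ∣ X ∣ ℤ.- + ∣ X ∣))
    pairsOnLine-card X = begin
      pairsOnLine X
        ≡⟨ ΣF-cong n (λ e → trans (ΣF-ind (isFlat? M X) n _) (cong (ind (isFlat? M X)) (ΣF-ind (rk X ℕ.≟ 2) n _))) ⟩
      ΣF n (λ e → ind (isFlat? M X) (ind (rk X ℕ.≟ 2) (ΣF n (λ f → ind (e ∈? X) (ind (f ∈? X) (distinct e f))))))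
        ≡⟨ trans (ΣF-ind (isFlat? M X) n _) (cong (ind (isFlat? M X)) (ΣF-ind (rk X ℕ.≟ 2) n _)) ⟩
      ind (isFlat? M X) (ind (rk X ℕ.≟ 2) (ΣF n (λ e → ΣF n (λ f → ind (e ∈? X) (ind (f ∈? X) (distinct e f))))))
        ≡⟨ cong (λ w → ind (isFlat? M X) (ind (rk X ℕ.≟ 2) w)) (ordered-pairs X) ⟩
      ind (isFlat? M X) (ind (rk X ℕ.≟ 2) (+ ∣ X ∣ ℤ.* + ∣ X ∣ ℤ.- + ∣ X ∣)) ∎
      where open ≡.≡-Reasoning

    -- summing over all X, each of the n² - n ordered pairs is counted once
    sum-pairsOnLine : ΣS n pairsOnLine ≡ + n ℤ.* (+ n ℤ.* + 1 ℤ.- + 1)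
    sum-pairsOnLine = begin
      ΣS n pairsOnLine                                        ≡⟨ ΣS-ΣF n n (λ X e → ΣF n (λ f → onLine e f X)) ⟩
      ΣF n (λ e → ΣS n (λ X → ΣF n (λ f → onLine e f X)))     ≡⟨ ΣF-cong n (λ e → ΣS-ΣF n n (λ X f → onLine e f X)) ⟩
      ΣF n (λ e → ΣF n (λ f → ΣS n (onLine e f)))             ≡⟨ ΣF-cong n (λ e → ΣF-cong n (lines-through e)) ⟩
      ΣF n (λ e → ΣF n (distinct e))                          ≡⟨ ΣF-cong n others ⟩
      ΣF n (λ _ → + n ℤ.* + 1 ℤ.- + 1)                        ≡⟨ ΣF-const n _ ⟩
      + n ℤ.* (+ n ℤ.* + 1 ℤ.- + 1)                           ∎
      where
      open ≡.≡-Reasoning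
      others : ∀ e → ΣF n (distinct e) ≡ + n ℤ.* + 1 ℤ.- + 1
      others e = trans (ΣF-cong n (λ f → ind-not (e FinP.≟ f))) (trans (ΣF-sub n _ _)
        (cong₂ ℤ._-_ (ΣF-const n (+ 1)) (trans (ΣF-point n _ e (λ f f≢e → ind-no (e FinP.≟ f) (λ e≡f → f≢e (sym e≡f))))
                                               (ind-yes (e FinP.≟ e) refl))))

    module SecondCoefficient (short : ∀ X → IsLine M X → ∣ X ∣ ≤ 3) where
      open Simple.ShortLines M simple short

      triangle : Subset n → ℤ
      triangle X = ind ((∣ X ∣ ℕ.≟ 3) ×-dec isCircuit? M X) (+ 1)

      triangles : + numTriangles M ≡ ΣS n triangle
      triangles = trans (length-filter (λ C → (∣ C ∣ ℕ.≟ 3) ×-dec isCircuit? M C) (subsets n)) (sum-subsets n _)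

      -- a line L has μ(L) = |L| - 1 and |L| ∈ {2, 3}, so
      -- 2 μ(L) + 2 [|L| = 3] = |L|² - |L|; other sets contribute nothing
      line-identity : ∀ X → let λX = ind (isFlat? M X) (ind (rk X ℕ.≟ 2) (μ X)) in
                      λX ℤ.+ λX ℤ.+ (triangle X ℤ.+ triangle X) ≡ ind (isFlat? M X) (ind (rk X ℕ.≟ 2) (+ ∣ X ∣ ℤ.* + ∣ X ∣ ℤ.- + ∣ X ∣))
      line-identity X = by-cases (isFlat? M X) (rk X ℕ.≟ 2) ((∣ X ∣ ℕ.≟ 3) ×-dec isCircuit? M X)
        where
        by-cases : (d₁ : Dec (IsFlat M X)) (d₂ : Dec (rk X ≡ 2)) (d₃ : Dec (∣ X ∣ ≡ 3 × IsCircuit M X)) →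
                   ind d₁ (ind d₂ (μ X)) ℤ.+ ind d₁ (ind d₂ (μ X)) ℤ.+ (ind d₃ (+ 1) ℤ.+ ind d₃ (+ 1))
                     ≡ ind d₁ (ind d₂ (+ ∣ X ∣ ℤ.* + ∣ X ∣ ℤ.- + ∣ X ∣))
        by-cases (no ¬flat) d₂ d₃ = trans (ℤP.+-identityˡ _)
          (cong (λ w → w ℤ.+ w) (ind-no d₃ (λ (∣X∣≡3 , circuit) → ¬flat (proj₁ (triangle⇒line ∣X∣≡3 circuit)))))
        by-cases (yes _) (no ¬rk2) d₃ = trans (ℤP.+-identityˡ _)
          (cong (λ w → w ℤ.+ w) (ind-no d₃ (λ (∣X∣≡3 , circuit) → ¬rk2 (proj₂ (triangle⇒line ∣X∣≡3 circuit)))))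
        by-cases (yes flat) (yes rk2) d₃ =
          trans (cong (λ w → w ℤ.+ w ℤ.+ (ind d₃ (+ 1) ℤ.+ ind d₃ (+ 1))) (mu-line (flat , rk2)))
                (by-size ∣ X ∣ refl (ℕP.≤-trans (ℕP.≤-reflexive (sym rk2)) (rk-card X)) (short X (flat , rk2)))
          where
          by-size : ∀ c → ∣ X ∣ ≡ c → 2 ≤ c → c ≤ 3 →
                    (+ c ℤ.- + 1) ℤ.+ (+ c ℤ.- + 1) ℤ.+ (ind d₃ (+ 1) ℤ.+ ind d₃ (+ 1)) ≡ + c ℤ.* + c ℤ.- + c
          by-size 2 ∣X∣≡2 _ _ = cong (λ w → + 2 ℤ.+ (w ℤ.+ w)) (ind-no d₃ (λ (∣X∣≡3 , _) → contradiction (trans (sym ∣X∣≡2) ∣X∣≡3) λ ()))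
          by-size 3 ∣X∣≡3 _ _ = cong (λ w → + 4 ℤ.+ (w ℤ.+ w)) (ind-yes d₃ (∣X∣≡3 , line⇒triangle ∣X∣≡3 (flat , rk2)))
          by-size (suc (suc (suc (suc _)))) _ _ (s≤s (s≤s (s≤s ())))
          by-size 0 _ () _
          by-size 1 _ (s≤s ()) _

      -- [λ^(r-2)] χ = Σ_{lines L} μ(L), hence 2 [λ^(r-2)] χ + 2t + n = n²
      chiCoeff-corank2 : ∀ k → suc (suc k) ≡ r → chiCoeff M k ℤ.+ chiCoeff M k ℤ.+ + (2 ℕ.* numTriangles M) ℤ.+ + n ≡ + (n ℕ.* n)
      chiCoeff-corank2 k 2+k≡r = begin
        C ℤ.+ C ℤ.+ + (2 ℕ.* t) ℤ.+ + n             ≡⟨ cong (λ w → C ℤ.+ C ℤ.+ w ℤ.+ + n) (ℤP.pos-* 2 t) ⟩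
        C ℤ.+ C ℤ.+ + 2 ℤ.* + t ℤ.+ + n             ≡⟨ regroup C (+ t) (+ n) ⟩
        (C ℤ.+ C ℤ.+ (+ t ℤ.+ + t)) ℤ.+ + n         ≡⟨ cong (ℤ._+ + n) count ⟩
        + n ℤ.* (+ n ℤ.* + 1 ℤ.- + 1) ℤ.+ + n       ≡⟨ simplify (+ n) ⟩
        + n ℤ.* + n                                 ≡⟨ ℤP.pos-* n n ⟨
        + (n ℕ.* n)                                 ∎
        where
        open ≡.≡-Reasoning
        C = chiCoeff M k
        t = numTriangles M
        regroup : ∀ c t n → c ℤ.+ c ℤ.+ + 2 ℤ.* t ℤ.+ n ≡ (c ℤ.+ c ℤ.+ (t ℤ.+ t)) ℤ.+ n
        regroup = solve-∀
        simplify : ∀ n → n ℤ.* (n ℤ.* + 1 ℤ.- + 1) ℤ.+ n ≡ n ℤ.* n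
        simplify = solve-∀
        whitney-lines : ∀ X → whitney k X ≡ ind (isFlat? M X) (ind (rk X ℕ.≟ 2) (μ X))
        whitney-lines X = cong (ind (isFlat? M X)) (ind-iff (rk X ℕ.+ k ℕ.≟ r) (rk X ℕ.≟ 2) (μ X)
          (λ eq → ℕP.+-cancelʳ-≡ k (rk X) 2 (trans eq (sym 2+k≡r)))
          (λ eq → trans (cong (ℕ._+ k) eq) 2+k≡r))
        count : C ℤ.+ C ℤ.+ (+ t ℤ.+ + t) ≡ + n ℤ.* (+ n ℤ.* + 1 ℤ.- + 1)
        count = begin
          C ℤ.+ C ℤ.+ (+ t ℤ.+ + t)
            ≡⟨ cong₂ (λ a b → a ℤ.+ a ℤ.+ (b ℤ.+ b)) (trans (chiCoeff-whitney k) (ΣS-cong n whitney-lines)) triangles ⟩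
          ΣS n λX ℤ.+ ΣS n λX ℤ.+ (ΣS n triangle ℤ.+ ΣS n triangle)
            ≡⟨ sym (trans (ΣS-+ n _ _) (cong₂ ℤ._+_ (ΣS-+ n _ _) (ΣS-+ n _ _))) ⟩
          ΣS n (λ X → λX X ℤ.+ λX X ℤ.+ (triangle X ℤ.+ triangle X))
            ≡⟨ ΣS-cong n (λ X → trans (line-identity X) (sym (pairsOnLine-card X))) ⟩
          ΣS n pairsOnLine
            ≡⟨ sum-pairsOnLine ⟩
          + n ℤ.* (+ n ℤ.* + 1 ℤ.- + 1) ∎
          where
          λX : Subset n → ℤ
          λX X = ind (isFlat? M X) (ind (rk X ℕ.≟ 2) (μ X))

      chiPoly-corank2 : ∀ k → suc (suc k) ≡ r →
                        coeffℤ (chiPoly M) k ℤ.+ coeffℤ (chiPoly M) k ℤ.+ + (2 ℕ.* numTriangles M) ℤ.+ + n ≡ + (n ℕ.* n)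
      chiPoly-corank2 k 2+k≡r = ≡.subst (λ c → c ℤ.+ c ℤ.+ + (2 ℕ.* numTriangles M) ℤ.+ + n ≡ + (n ℕ.* n))
        (sym (chiPoly-coeff k (ℕP.≤-trans (ℕP.≤-trans (ℕP.n≤1+n k) (ℕP.n≤1+n (suc k))) (ℕP.≤-reflexive 2+k≡r))))
        (chiCoeff-corank2 k 2+k≡r)

open import Defs
open import Level using (0ℓ)
open import Data.Nat using (ℕ; _+_; _*_; _∸_; _≤_)
open import Data.Integer using (+_)
open import Data.Fin.Subset using (∣_∣)
open import Data.Product using (_×_)
open import Relation.Binary.PropositionalEquality using (_≡_)
open import Function.Bundles using (_⇔_)

open import Data.Nat using (zero; suc; s≤s; z≤n)
import Data.Nat.Properties as ℕP
open import Data.Product using (Σ; _,_)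
open import Data.Fin.Subset using (⊤)
open import Data.Fin.Subset.Properties using (∣⊤∣≡n)
open import Relation.Nullary.Negation using (contradiction)
import Relation.Binary.PropositionalEquality as ≡
open RootBound using (module RealRooted)
open CharPoly using (module Coefficients)

-- n + 3 = 3r with r ≤ n forces r ≥ 2
rank≥2 : ∀ {n} (M : Matroid n) → n + 3 ≡ 3 * rank M → Σ ℕ λ r' → rank M ≡ suc (suc r')
rank≥2 {n} M elements with rank M in rank≡ | Matroid.rk-card M ⊤
... | zero           | _ = contradiction (≡.trans (ℕP.+-comm 3 n) (≡.trans elements (ℕP.*-zeroʳ 3))) λ ()
... | suc zero       | r≤∣E∣ = contradiction (ℕP.≤-trans r≤∣E∣ (ℕP.≤-reflexive (≡.trans (∣⊤∣≡n n) n≡0))) λ ()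
  where
  n≡0 : n ≡ 0
  n≡0 = ℕP.+-cancelʳ-≡ 3 n 0 elements
... | suc (suc r')   | _ = r' , ≡.refl

lemma4p1 : ∀ {n : ℕ} (M : Matroid n) (K : OrderedField 0ℓ 0ℓ 0ℓ)
    → IsSimple M
    → n + 3 ≡ 3 * rank M
    → (∀ X → IsLine M X → ∣ X ∣ ≤ 3)
    → AllRootsIn K (rank M) (chiPoly M)
    → chi M (+ 2) ≡ + 0
    → (3 * rank M ≤ numTriangles M + 5)
    × ((numTriangles M + 5 ≡ 3 * rank M)
    ⇔ (∀ k → coeffℤ (chiPoly M) k
    ≡ coeffℤ ((linℤ (+ 1)) *ℤ ((linℤ (+ 2)) *ℤ ((linℤ (+ 3)) ^ℤ (rank M ∸ 2)))) k))
lemma4p1 {n} M K simple elements short realRooted root-two with rank≥2 M elements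
... | r' , rank≡ = ≡.subst Conclusion (≡.sym rank≡)
      (RealRooted.conclusion K (chiPoly M) r' n (numTriangles M)
        (≡.trans elements (≡.cong (3 *_) rank≡))
        (chiPoly-corank1 (suc r') (≡.sym rank≡))
        (SecondCoefficient.chiPoly-corank2 short r' (≡.sym rank≡))
        (chi-one (ℕP.≤-trans (s≤s z≤n) (ℕP.≤-reflexive (≡.sym rank≡))))
        root-two
        (≡.subst (λ r → AllRootsIn K r (chiPoly M)) rank≡ realRooted))
  where
  open Coefficients M simple
  Conclusion : ℕ → Set
  Conclusion r = (3 * r ≤ numTriangles M + 5)
    × ((numTriangles M + 5 ≡ 3 * r)
    ⇔ (∀ k → coeffℤ (chiPoly M) k ≡ coeffℤ ((linℤ (+ 1)) *ℤ ((linℤ (+ 2)) *ℤ ((linℤ (+ 3)) ^ℤ (r ∸ 2)))) k))
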